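{- Let $g \geq 9$ be an integer and let $\mathcal{S}_{4,g}$ be the set of numerical semigroups with multiplicity $4$ and genus $g$. Then $\#\mathcal{S}_{4,g} = -g + \frac{5}{2} \lfloor \frac{g}{4} \rfloor +\lfloor \frac{g}{2} \rfloor+\frac{1}{2}\lfloor \frac{g+5}{6} \rfloor+\lfloor \frac{g+5}{6} \rfloor g -\lfloor \frac{g+5}{6} \rfloor\lfloor \frac{g}{2} \rfloor-\frac{3}{2}\lfloor \frac{g+5}{6} \rfloor^2-\lfloor \frac{g}{4} \rfloor g+\frac{3}{2} \lfloor \frac{g}{4} \rfloor^2+\lfloor \frac{g}{4} \rfloor\lfloor \frac{g}{2} \rfloor-\frac{1}{2}\lfloor \frac{g+2}{6} \rfloor+\lfloor \frac{g+2}{6} \rfloor\lfloor \frac{g}{2} \rfloor-\frac{3}{2}\lfloor \frac{g+2}{6} \rfloor^2+\frac{1}{2} \lfloor \frac{g+2}{4} \rfloor+\frac{3}{2} \lfloor \frac{g+2}{4} \rfloor^2-\lfloor \frac{g+2}{4} \rfloor\lfloor \frac{g}{2} \rfloor+\lfloor \frac{g+1}{2} \rfloor\lfloor \frac{g}{2} \rfloor-\lfloor \frac{g+1}{2} \rfloor\lceil \frac{2g-3}{8} \rceil+\lfloor \frac{g+1}{2} \rfloor-\lceil \frac{2g-7}{8} \rceil \lfloor \frac{g}{2} \rfloor+\lceil \frac{2g-7}{8} \rceil\lceil \frac{2g-3}{8} \rceil-\lceil \frac{2g-7}{8} \rceil$.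
   Context: A numerical semigroup is a subset $S \subseteq \mathbb{N}$ containing $0$, closed under addition, with $\mathbb{N}\setminus S$ finite. Its multiplicity is $\min(S\setminus\{0\})$ and its genus is $\#(\mathbb{N}\setminus S)$. -}

module Defs where

open import Data.Bool using (Bool; true; false)
open import Data.Nat using (ℕ; zero; suc; _<_; NonZero) renaming (_+_ to _+ℕ_; _*_ to _*ℕ_; _∸_ to _∸ℕ_)
open import Data.Nat.DivMod using () renaming (_/_ to _/ℕ_)
open import Data.Fin using (Fin)
open import Data.List using (List; length)
open import Data.List.Membership.Propositional using (_∈_)
open import Data.List.Relation.Unary.Unique.Propositional using (Unique)
open import Data.Product using (Σ; _×_; _,_; proj₁)
open import Data.Integer as Z using (ℤ; +_)
open import Relation.Binary.PropositionalEquality using (_≡_)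
open import Function.Bundles using (_⇔_)

NatSubset : Set
NatSubset = ℕ → Bool

HasGenus : NatSubset → ℕ → Set
HasGenus S g = Σ (List ℕ) λ l →
  Unique l × length l ≡ g × (∀ n → (n ∈ l) ⇔ (S n ≡ false))

IsNumericalSemigroup : NatSubset → Set
IsNumericalSemigroup S =
  S 0 ≡ true ×
  (∀ a b → S a ≡ true → S b ≡ true → S (a +ℕ b) ≡ true) ×
  Σ ℕ (HasGenus S)

HasMultiplicity : NatSubset → ℕ → Set
HasMultiplicity S m =
  0 < m × S m ≡ true × (∀ k → 0 < k → k < m → S k ≡ false)

𝒮 : ℕ → ℕ → Set
𝒮 m g = Σ NatSubset λ S →
  IsNumericalSemigroup S × HasMultiplicity S m × HasGenus S g

-- Two elements of 𝒮 m g are the same semigroup iff they have the same elements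
-- (the proof components are irrelevant).
_≈𝒮_ : ∀ {m g} → 𝒮 m g → 𝒮 m g → Set
A ≈𝒮 B = ∀ n → proj₁ A n ≡ proj₁ B n

HasCardinality : (A : Set) → (A → A → Set) → ℕ → Set
HasCardinality A _≈_ N = Σ (Fin N → A) λ f →
  (∀ i j → f i ≈ f j → i ≡ j) × (∀ a → Σ (Fin N) λ i → f i ≈ a)

⌈_/_⌉ : ℕ → (b : ℕ) → .{{_ : NonZero b}} → ℕ
⌈ a / b ⌉ = (a +ℕ (b ∸ℕ 1)) /ℕ b

-- Twice the right-hand side of the formula (all terms are doubled so that the
-- halves become integers); floors of nonnegative quotients are ℕ-division,
-- and for g ≥ 9 the quantities 2g-3, 2g-7 are positive so ℕ-subtraction is exact.
twiceFormula : (g : ℕ) → ℤ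
twiceFormula g = formula (+ g) (+ (g /ℕ 4)) (+ (g /ℕ 2)) (+ ((g +ℕ 5) /ℕ 6))
  (+ ((g +ℕ 2) /ℕ 6)) (+ ((g +ℕ 2) /ℕ 4)) (+ ((g +ℕ 1) /ℕ 2))
  (+ ⌈ (2 *ℕ g ∸ℕ 3) / 8 ⌉) (+ ⌈ (2 *ℕ g ∸ℕ 7) / 8 ⌉)
  where
  open Z using (_+_; _*_; _-_; -_)
  -- G = g, A = ⌊g/4⌋, B = ⌊g/2⌋, C = ⌊(g+5)/6⌋, D = ⌊(g+2)/6⌋, E = ⌊(g+2)/4⌋,
  -- F = ⌊(g+1)/2⌋, H = ⌈(2g-3)/8⌉, I = ⌈(2g-7)/8⌉
  formula : ℤ → ℤ → ℤ → ℤ → ℤ → ℤ → ℤ → ℤ → ℤ → ℤ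
  formula G A B C D E F H I =
      - (+ 2 * G) + + 5 * A + + 2 * B + C + + 2 * C * G - + 2 * C * B
      - + 3 * C * C - + 2 * A * G + + 3 * A * A + + 2 * A * B
      - D + + 2 * D * B - + 3 * D * D + E + + 3 * E * E - + 2 * E * B
      + + 2 * F * B - + 2 * F * H + + 2 * F - + 2 * I * B + + 2 * I * H - + 2 * I

-- A numerical semigroup S of multiplicity 4 is determined by its Kunz coordinates (a, b, k): for
-- r = 1, 2, 3 the least x with 4x + r ∈ S.  A triple arises in this way exactly when a, b, k ≥ 1,
-- b ≤ 2a, k ≤ a + b, a ≤ b + k + 1 and b ≤ 2k + 1 (closure of the Apéry set under addition), and the
-- genus is a + b + k.  Eliminating k = g − a − b, the semigroups of genus g ≥ 9 correspond to the
-- lattice points 1 ≤ a ≤ ⌈g/2⌉, max(1, ⌈g/2⌉ − a) ≤ b ≤ min(2a, ⌊(2g + 1 − 2a)/3⌋).  Cutting the rows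
-- at a = ⌊(2g + 1)/8⌋, where the binding upper bound on b changes, shows that the number N(g) of
-- these points satisfies N(g + 12) = N(g) + 2g + 18.  Twice the formula grows by 2(2g + 18) as well,
-- a polynomial identity once its floors are written in terms of their values at g, and the twelve
-- cases g = 9, …, 20 are checked by evaluation.

module Submission where

open import Data.Bool using (Bool; true; false; if_then_else_)
open import Data.Empty using (⊥; ⊥-elim)
open import Data.Fin as Fin using (Fin)
import Data.Integer as ℤ
open import Data.Integer.Properties using (pos-+; pos-*; ⊖-≥; m-n≡m⊖n)
open import Data.Integer.Tactic.RingSolver using () renaming (ring to ℤ-ring)
open import Data.List using (List; []; _∷_; _++_; length; map; lookup; applyUpTo)
open import Data.List.Membership.Propositional using (_∈_; _─_)
open import Data.List.Membership.Propositional.Properties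
  using (∈-lookup; ∈-applyUpTo⁺; ∈-applyUpTo⁻; ∈-++⁺ˡ; ∈-++⁺ʳ; ∈-++⁻; ∈-map⁺; ∈-map⁻)
open import Data.List.Properties using (length-++; length-map; length-applyUpTo; length-removeAt′)
open import Data.List.Relation.Binary.Subset.Propositional using (_⊆_)
import Data.List.Relation.Unary.All as All
open import Data.List.Relation.Unary.Any using (here; there; index)
open import Data.List.Relation.Unary.Any.Properties using (lookup-index)
open import Data.List.Relation.Unary.Unique.Propositional using (Unique; []; _∷_)
import Data.List.Relation.Unary.Unique.Propositional.Properties as Unique
open import Data.Nat
open import Data.Nat.DivMod
  using (_/_; _%_; m/n*n≤m; m%n<n; m≡m%n+[m/n]*n; m*n/n≡m; +-distrib-/-∣ˡ; m*n/m*o≡n/o; /-congˡ; m/n≤m)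
open import Data.Nat.Divisibility using (divides)
open import Data.Nat.ListAction using (sum)
open import Data.Nat.Properties
open import Data.Nat.Tactic.RingSolver using (solve-∀)
open import Data.Product using (Σ; ∃₂; _×_; _,_; proj₁; proj₂; map₁; uncurry)
open import Data.Sum using (inj₁; inj₂; [_,_]′)
open import Function.Base using (_∘_)
open import Function.Bundles using (_⇔_; mk⇔; Equivalence)
open import Relation.Binary.PropositionalEquality
open import Relation.Nullary using (¬_; Dec; yes; no; does)
open import Relation.Nullary.Decidable using (dec-true; dec-false)
open import Tactic.RingSolver.NonReflective ℤ-ring
  using (_⊜_; Expr; Κ) renaming (solve to solve-ℤ; _⊕_ to _:+_; _⊗_ to _:*_; ⊝_ to :-_)

open import Defs

open Equivalence using (to; from)

≤-quotient : ∀ d {x q n} → n < d * suc q → d * x ≤ n → x ≤ q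
≤-quotient d lt le = ≤-pred (*-cancelˡ-< d _ _ (≤-<-trans le lt))

m*[n/m]≤n : ∀ m n .{{_ : NonZero m}} → m * (n / m) ≤ n
m*[n/m]≤n m n = subst (_≤ n) (*-comm (n / m) m) (m/n*n≤m n m)

n<m*[1+n/m] : ∀ m n .{{_ : NonZero m}} → n < m * suc (n / m)
n<m*[1+n/m] m n = begin-strict
  n                     ≡⟨ m≡m%n+[m/n]*n n m ⟩
  n % m + n / m * m     <⟨ +-monoˡ-< (n / m * m) (m%n<n n m) ⟩
  m + n / m * m         ≡⟨ cong (m +_) (*-comm m (n / m)) ⟨
  m + m * (n / m)       ≡⟨ *-suc m (n / m) ⟨
  m * suc (n / m)       ∎
  where open ≤-Reasoning

≤-/ : ∀ m {x} n .{{_ : NonZero m}} → m * x ≤ n → x ≤ n / m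
≤-/ m n = ≤-quotient m (n<m*[1+n/m] m n)

[k*m+n]/m≡k+n/m : ∀ m k n .{{_ : NonZero m}} → (k * m + n) / m ≡ k + n / m
[k*m+n]/m≡k+n/m m k n = trans (+-distrib-/-∣ˡ n (divides k refl)) (cong (_+ n / m) (m*n/n≡m k m))

2*⌊n/2⌋≤n : ∀ n → 2 * ⌊ n /2⌋ ≤ n
2*⌊n/2⌋≤n zero = z≤n
2*⌊n/2⌋≤n (suc zero) = z≤n
2*⌊n/2⌋≤n (suc (suc n)) = subst (_≤ 2 + n) (sym (*-suc 2 ⌊ n /2⌋)) (+-monoʳ-≤ 2 (2*⌊n/2⌋≤n n))

n<2*[1+⌊n/2⌋] : ∀ n → n < 2 * suc ⌊ n /2⌋
n<2*[1+⌊n/2⌋] zero = s≤s z≤n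
n<2*[1+⌊n/2⌋] (suc zero) = s≤s (s≤s z≤n)
n<2*[1+⌊n/2⌋] (suc (suc n)) =
  subst (2 + n <_) (sym (*-suc 2 (suc ⌊ n /2⌋))) (+-monoʳ-< 2 (n<2*[1+⌊n/2⌋] n))

2*⌈n/2⌉≤1+n : ∀ n → 2 * ⌈ n /2⌉ ≤ suc n
2*⌈n/2⌉≤1+n n = 2*⌊n/2⌋≤n (suc n)

n≤2*⌈n/2⌉ : ∀ n → n ≤ 2 * ⌈ n /2⌉
n≤2*⌈n/2⌉ zero = z≤n
n≤2*⌈n/2⌉ (suc zero) = s≤s z≤n
n≤2*⌈n/2⌉ (suc (suc n)) =
  subst (2 + n ≤_) (sym (*-suc 2 ⌈ n /2⌉)) (+-monoʳ-≤ 2 (n≤2*⌈n/2⌉ n))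

≤-⌈/2⌉ : ∀ {x} n → 2 * x ≤ suc n → x ≤ ⌈ n /2⌉
≤-⌈/2⌉ n = ≤-quotient 2 (n<2*[1+⌊n/2⌋] (suc n))

⌈n/2⌉≤m : ∀ n {m} → n ≤ 2 * m → ⌈ n /2⌉ ≤ m
⌈n/2⌉≤m n {m} n≤2m =
  ≤-quotient 2 (subst (suc n <_) (sym (*-suc 2 m)) (s≤s (s≤s n≤2m))) (2*⌈n/2⌉≤1+n n)

n/3+[1+n]/3+[2+n]/3≡n : ∀ n → n / 3 + (1 + n) / 3 + (2 + n) / 3 ≡ n
n/3+[1+n]/3+[2+n]/3≡n 0 = refl
n/3+[1+n]/3+[2+n]/3≡n 1 = refl
n/3+[1+n]/3+[2+n]/3≡n 2 = refl
n/3+[1+n]/3+[2+n]/3≡n (suc (suc (suc n))) = begin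
  (3 + n) / 3 + (4 + n) / 3 + (5 + n) / 3
    ≡⟨ cong₂ _+_ (cong₂ _+_ (shift n) (shift (1 + n))) (shift (2 + n)) ⟩
  suc (n / 3) + suc ((1 + n) / 3) + suc ((2 + n) / 3)
    ≡⟨ sum-suc (n / 3) ((1 + n) / 3) ((2 + n) / 3) ⟩
  3 + (n / 3 + (1 + n) / 3 + (2 + n) / 3)
    ≡⟨ cong (3 +_) (n/3+[1+n]/3+[2+n]/3≡n n) ⟩
  3 + n ∎
  where
  open ≡-Reasoning
  shift : ∀ m → (3 + m) / 3 ≡ suc (m / 3)
  shift m = [k*m+n]/m≡k+n/m 3 1 m
  sum-suc : ∀ x y z → suc x + suc y + suc z ≡ 3 + (x + y + z)
  sum-suc = solve-∀

n/2+[n+1]/2≡n : ∀ n → n / 2 + (n + 1) / 2 ≡ n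
n/2+[n+1]/2≡n 0 = refl
n/2+[n+1]/2≡n 1 = refl
n/2+[n+1]/2≡n (suc (suc n)) = begin
  (2 + n) / 2 + (2 + n + 1) / 2
    ≡⟨ cong₂ _+_ ([k*m+n]/m≡k+n/m 2 1 n) ([k*m+n]/m≡k+n/m 2 1 (n + 1)) ⟩
  suc (n / 2) + suc ((n + 1) / 2)      ≡⟨ cong suc (+-suc (n / 2) ((n + 1) / 2)) ⟩
  suc (suc (n / 2 + (n + 1) / 2))      ≡⟨ cong (suc ∘ suc) (n/2+[n+1]/2≡n n) ⟩
  suc (suc n)                          ∎
  where open ≡-Reasoning

⌈[2n∸3]/8⌉≡[n+2]/4 : ∀ n → 2 ≤ n → ⌈ (2 * n ∸ 3) / 8 ⌉ ≡ (n + 2) / 4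
⌈[2n∸3]/8⌉≡[n+2]/4 n 2≤n = trans (/-congˡ numerator) (m*n/m*o≡n/o 2 (n + 2) 4)
  where
  numerator : 2 * n ∸ 3 + 7 ≡ 2 * (n + 2)
  numerator = begin
    2 * n ∸ 3 + 7      ≡⟨ +-assoc (2 * n ∸ 3) 3 4 ⟨
    2 * n ∸ 3 + 3 + 4  ≡⟨ cong (_+ 4) (m∸n+n≡m (≤-trans (n≤1+n 3) (*-monoʳ-≤ 2 2≤n))) ⟩
    2 * n + 4          ≡⟨ *-distribˡ-+ 2 n 2 ⟨
    2 * (n + 2)        ∎
    where open ≡-Reasoning

⌈[2n∸7]/8⌉≡n/4 : ∀ n → 4 ≤ n → ⌈ (2 * n ∸ 7) / 8 ⌉ ≡ n / 4
⌈[2n∸7]/8⌉≡n/4 n 4≤n =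
  trans (/-congˡ (m∸n+n≡m (≤-trans (n≤1+n 7) (*-monoʳ-≤ 2 4≤n)))) (m*n/m*o≡n/o 2 n 4)

m<n∸o⇒o+m<n : ∀ o {m n} → m < n ∸ o → o + m < n
m<n∸o⇒o+m<n zero lt = lt
m<n∸o⇒o+m<n (suc o) {n = suc n} lt = s≤s (m<n∸o⇒o+m<n o lt)

m∸[n∸o]≡[m+o]∸n : ∀ m {n o} → o ≤ n → m ∸ (n ∸ o) ≡ (m + o) ∸ n
m∸[n∸o]≡[m+o]∸n m {n} {o} o≤n = begin
  m ∸ (n ∸ o)              ≡⟨ [m+n]∸[m+o]≡n∸o o m (n ∸ o) ⟨
  (o + m) ∸ (o + (n ∸ o))  ≡⟨ cong₂ _∸_ (+-comm o m) (m+[n∸m]≡n o≤n) ⟩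
  (m + o) ∸ n              ∎
  where open ≡-Reasoning

+-cancelˡ-≤-⇔ : ∀ c {x y x′ y′} → x ≡ c + x′ → y ≡ c + y′ → (x ≤ y) ⇔ (x′ ≤ y′)
+-cancelˡ-≤-⇔ c x≡ y≡ = mk⇔
  (λ x≤y → +-cancelˡ-≤ c _ _ (subst₂ _≤_ x≡ y≡ x≤y))
  (λ x′≤y′ → subst₂ _≤_ (sym x≡) (sym y≡) (+-monoʳ-≤ c x′≤y′))

dec-true⁻ : ∀ {A : Set} (d : Dec A) → does d ≡ true → A
dec-true⁻ (yes a) _ = a

dec-false⁻ : ∀ {A : Set} (d : Dec A) → does d ≡ false → ¬ A
dec-false⁻ (no ¬a) _ = ¬a

least : (ℕ → Bool) → ℕ → ℕ
least p zero = zero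
least p (suc n) = if p 0 then 0 else suc (least (p ∘ suc) n)

least-satisfies : ∀ (p : ℕ → Bool) n → p n ≡ true → p (least p n) ≡ true
least-satisfies p zero pn = pn
least-satisfies p (suc n) pn with p 0 in p0
... | true = p0
... | false = least-satisfies (p ∘ suc) n pn

least-minimal : ∀ (p : ℕ → Bool) n {y} → y < least p n → p y ≡ false
least-minimal p (suc n) {y} y<least with p 0 in p0
least-minimal p (suc n) {zero} _ | false = p0
least-minimal p (suc n) {suc y} (s≤s y<least) | false = least-minimal (p ∘ suc) n y<least

∈⇒≤sum : ∀ {x} xs → x ∈ xs → x ≤ sum xs
∈⇒≤sum (y ∷ ys) (here refl) = m≤m+n y (sum ys)
∈⇒≤sum (y ∷ ys) (there p) = ≤-trans (∈⇒≤sum ys p) (m≤n+m (sum ys) y)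

∈-─ : ∀ {A : Set} {x y : A} {xs} (p : x ∈ xs) → y ∈ xs → y ≢ x → y ∈ xs ─ p
∈-─ (here refl) (here refl) y≢x = ⊥-elim (y≢x refl)
∈-─ (here _) (there q) _ = q
∈-─ (there p) (here refl) _ = here refl
∈-─ (there p) (there q) y≢x = there (∈-─ p q y≢x)

Unique∧⊆⇒length≤ : ∀ {A : Set} {xs ys : List A} → Unique xs → xs ⊆ ys → length xs ≤ length ys
Unique∧⊆⇒length≤ [] _ = z≤n
Unique∧⊆⇒length≤ {xs = x ∷ xs} {ys} (x∉xs ∷ xs-unique) xs⊆ys =
  subst (suc (length xs) ≤_) (sym (length-removeAt′ ys (index x∈ys)))
    (s≤s (Unique∧⊆⇒length≤ xs-unique
      (λ q → ∈-─ x∈ys (xs⊆ys (there q)) (λ eq → All.lookup x∉xs q (sym eq)))))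
  where x∈ys = xs⊆ys (here refl)

lookup-injective : ∀ {A : Set} {xs : List A} → Unique xs → ∀ i j → lookup xs i ≡ lookup xs j → i ≡ j
lookup-injective (_ ∷ _) Fin.zero Fin.zero _ = refl
lookup-injective (x∉xs ∷ _) Fin.zero (Fin.suc j) eq = ⊥-elim (All.lookup x∉xs (∈-lookup j) eq)
lookup-injective (x∉xs ∷ _) (Fin.suc i) Fin.zero eq = ⊥-elim (All.lookup x∉xs (∈-lookup i) (sym eq))
lookup-injective (_ ∷ xs-unique) (Fin.suc i) (Fin.suc j) eq = cong Fin.suc (lookup-injective xs-unique i j eq)

[_‥_] : ℕ → ℕ → List ℕ
[ lo ‥ hi ] = applyUpTo (lo +_) (suc hi ∸ lo)

∈-‥⁺ : ∀ {lo hi y} → lo ≤ y → y ≤ hi → y ∈ [ lo ‥ hi ]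
∈-‥⁺ {lo} lo≤y y≤hi =
  subst (_∈ _) (m+[n∸m]≡n lo≤y) (∈-applyUpTo⁺ (lo +_) (∸-monoˡ-< (s≤s y≤hi) lo≤y))

∈-‥⁻ : ∀ {lo hi y} → y ∈ [ lo ‥ hi ] → lo ≤ y × y ≤ hi
∈-‥⁻ {lo} y∈ with ∈-applyUpTo⁻ (lo +_) y∈
... | i , i<len , refl = m≤m+n lo i , ≤-pred (m<n∸o⇒o+m<n lo i<len)

‥-unique : ∀ lo hi → Unique [ lo ‥ hi ]
‥-unique lo hi = Unique.applyUpTo⁺₁ (lo +_) _ (λ i<j _ eq → <⇒≢ i<j (+-cancelˡ-≡ lo _ _ eq))

sumFrom : (ℕ → ℕ) → ℕ → ℕ → ℕ
sumFrom f a zero = 0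
sumFrom f a (suc n) = f a + sumFrom f (suc a) n

sumFrom-++ : ∀ f a p q → sumFrom f a (p + q) ≡ sumFrom f a p + sumFrom f (a + p) q
sumFrom-++ f a zero q = cong (λ x → sumFrom f x q) (sym (+-identityʳ a))
sumFrom-++ f a (suc p) q = begin
  f a + sumFrom f (suc a) (p + q)
    ≡⟨ cong (f a +_) (sumFrom-++ f (suc a) p q) ⟩
  f a + (sumFrom f (suc a) p + sumFrom f (suc a + p) q)
    ≡⟨ +-assoc (f a) _ _ ⟨
  f a + sumFrom f (suc a) p + sumFrom f (suc (a + p)) q
    ≡⟨ cong (λ x → f a + sumFrom f (suc a) p + sumFrom f x q) (+-suc a p) ⟨
  f a + sumFrom f (suc a) p + sumFrom f (a + suc p) q ∎
  where open ≡-Reasoning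

sumFrom-snoc : ∀ f a n → sumFrom f a (suc n) ≡ sumFrom f a n + f (a + n)
sumFrom-snoc f a n = begin
  sumFrom f a (suc n)                  ≡⟨ cong (sumFrom f a) (+-comm 1 n) ⟩
  sumFrom f a (n + 1)                  ≡⟨ sumFrom-++ f a n 1 ⟩
  sumFrom f a n + (f (a + n) + 0)      ≡⟨ cong (sumFrom f a n +_) (+-identityʳ (f (a + n))) ⟩
  sumFrom f a n + f (a + n)            ∎
  where open ≡-Reasoning

sumFrom-cong : ∀ f h a b n → (∀ i → i < n → f (i + a) ≡ h (i + b)) → sumFrom f a n ≡ sumFrom h b n
sumFrom-cong f h a b zero _ = refl
sumFrom-cong f h a b (suc n) f≗h = cong₂ _+_ (f≗h 0 (s≤s z≤n))
  (sumFrom-cong f h (suc a) (suc b) n λ i i<n →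
    subst₂ (λ x y → f x ≡ h y) (sym (+-suc i a)) (sym (+-suc i b)) (f≗h (suc i) (s≤s i<n)))

sumFrom-+ : ∀ d f a n → sumFrom (λ x → d + f x) a n ≡ d * n + sumFrom f a n
sumFrom-+ d f a zero = sym (cong (_+ 0) (*-zeroʳ d))
sumFrom-+ d f a (suc n) = begin
  d + f a + sumFrom (λ x → d + f x) (suc a) n ≡⟨ cong (d + f a +_) (sumFrom-+ d f (suc a) n) ⟩
  d + f a + (d * n + sumFrom f (suc a) n)     ≡⟨ regroup d (f a) (d * n) (sumFrom f (suc a) n) ⟩
  d + d * n + (f a + sumFrom f (suc a) n)     ≡⟨ cong (_+ (f a + sumFrom f (suc a) n)) (*-suc d n) ⟨
  d * suc n + (f a + sumFrom f (suc a) n)     ∎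
  where
  open ≡-Reasoning
  regroup : ∀ x y z t → x + y + (z + t) ≡ x + z + (y + t)
  regroup = solve-∀

-- Residues modulo 4

data Residue : Set where
  r0 r1 r2 r3 : Residue

value : Residue → ℕ
value r0 = 0
value r1 = 1
value r2 = 2
value r3 = 3

infix 7 _·4+_

-- Defined by recursion rather than as 4 * x + value r, so that divMod4 (x ·4+ r) computes.
_·4+_ : ℕ → Residue → ℕ
zero ·4+ r = value r
suc x ·4+ r = 4 + x ·4+ r

divMod4 : ℕ → ℕ × Residue
divMod4 0 = 0 , r0
divMod4 1 = 0 , r1
divMod4 2 = 0 , r2
divMod4 3 = 0 , r3
divMod4 (suc (suc (suc (suc n)))) = map₁ suc (divMod4 n)

divMod4-·4+ : ∀ x r → divMod4 (x ·4+ r) ≡ (x , r)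
divMod4-·4+ zero r0 = refl
divMod4-·4+ zero r1 = refl
divMod4-·4+ zero r2 = refl
divMod4-·4+ zero r3 = refl
divMod4-·4+ (suc x) r = cong (map₁ suc) (divMod4-·4+ x r)

·4+-divMod4 : ∀ n → uncurry _·4+_ (divMod4 n) ≡ n
·4+-divMod4 0 = refl
·4+-divMod4 1 = refl
·4+-divMod4 2 = refl
·4+-divMod4 3 = refl
·4+-divMod4 (suc (suc (suc (suc n)))) = cong (4 +_) (·4+-divMod4 n)

·4+-injective : ∀ {x y r s} → x ·4+ r ≡ y ·4+ s → (x , r) ≡ (y , s)
·4+-injective {x} {y} {r} {s} eq =
  trans (sym (divMod4-·4+ x r)) (trans (cong divMod4 eq) (divMod4-·4+ y s))

·4+≡4*+ : ∀ x r → x ·4+ r ≡ 4 * x + value r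
·4+≡4*+ zero r = refl
·4+≡4*+ (suc x) r = begin
  4 + x ·4+ r           ≡⟨ cong (4 +_) (·4+≡4*+ x r) ⟩
  4 + (4 * x + value r) ≡⟨ +-assoc 4 (4 * x) (value r) ⟨
  4 + 4 * x + value r   ≡⟨ cong (_+ value r) (*-suc 4 x) ⟨
  4 * suc x + value r   ∎
  where open ≡-Reasoning

carry : Residue → Residue → ℕ
carry i j = proj₁ (divMod4 (value i + value j))

_⊕_ : Residue → Residue → Residue
i ⊕ j = proj₂ (divMod4 (value i + value j))

·4+-+ : ∀ x y i j → x ·4+ i + y ·4+ j ≡ (x + y + carry i j) ·4+ (i ⊕ j)
·4+-+ x y i j = begin
  x ·4+ i + y ·4+ j
    ≡⟨ cong₂ _+_ (·4+≡4*+ x i) (·4+≡4*+ y j) ⟩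
  (4 * x + value i) + (4 * y + value j)
    ≡⟨ regroup (4 * x) (4 * y) (value i) (value j) ⟩
  4 * x + 4 * y + (value i + value j)
    ≡⟨ cong (4 * x + 4 * y +_)
            (trans (sym (·4+-divMod4 (value i + value j))) (·4+≡4*+ (carry i j) (i ⊕ j))) ⟩
  4 * x + 4 * y + (4 * carry i j + value (i ⊕ j))
    ≡⟨ factor x y (carry i j) (value (i ⊕ j)) ⟩
  4 * (x + y + carry i j) + value (i ⊕ j)
    ≡⟨ ·4+≡4*+ (x + y + carry i j) (i ⊕ j) ⟨
  (x + y + carry i j) ·4+ (i ⊕ j) ∎
  where
  open ≡-Reasoning
  regroup : ∀ p q u v → (p + u) + (q + v) ≡ p + q + (u + v)
  regroup = solve-∀
  factor : ∀ x y c v → 4 * x + 4 * y + (4 * c + v) ≡ 4 * (x + y + c) + v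
  factor = solve-∀

x≤x·4+r : ∀ x r → x ≤ x ·4+ r
x≤x·4+r zero r = z≤n
x≤x·4+r (suc x) r = s≤s (≤-trans (x≤x·4+r x r) (m≤n+m (x ·4+ r) 3))

+-·4+ : ∀ d y r → (d + y) ·4+ r ≡ d ·4+ r0 + y ·4+ r
+-·4+ zero y r = refl
+-·4+ (suc d) y r = cong (4 +_) (+-·4+ d y r)

decompose : ∀ n → ∃₂ λ x r → n ≡ x ·4+ r
decompose n = proj₁ (divMod4 n) , proj₂ (divMod4 n) , sym (·4+-divMod4 n)

-- Kunz coordinates

record KunzInequalities (a b k : ℕ) : Set where
  field
    1≤a : 1 ≤ a
    1≤b : 1 ≤ b
    1≤k : 1 ≤ k
    b≤a+a : b ≤ a + a
    k≤a+b : k ≤ a + b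
    a≤1+b+k : a ≤ suc (b + k)
    b≤1+k+k : b ≤ suc (k + k)

-- level r is the least x with x ·4+ r in the semigroup, so (level r) ·4+ r runs over the
-- Apéry set of 4; the Kunz inequalities say that this set is closed under sums up to carries.
level : ℕ → ℕ → ℕ → Residue → ℕ
level a b k r0 = 0
level a b k r1 = a
level a b k r2 = b
level a b k r3 = k

kunzSemigroup : ℕ → ℕ → ℕ → NatSubset
kunzSemigroup a b k n = does (level a b k (proj₂ (divMod4 n)) ≤? proj₁ (divMod4 n))

gapsOfResidue : ℕ → Residue → List ℕ
gapsOfResidue l r = applyUpTo (_·4+ r) l

gapsOfResidue-unique : ∀ l r → Unique (gapsOfResidue l r)
gapsOfResidue-unique l r =
  Unique.applyUpTo⁺₁ (_·4+ r) l (λ i<j _ eq → <⇒≢ i<j (cong proj₁ (·4+-injective eq)))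

gapsOfResidue-disjoint : ∀ {l l′ r r′ v} → r ≢ r′ →
  v ∈ gapsOfResidue l r → v ∈ gapsOfResidue l′ r′ → ⊥
gapsOfResidue-disjoint r≢r′ v∈ v∈′ with ∈-applyUpTo⁻ _ v∈ | ∈-applyUpTo⁻ _ v∈′
... | i , _ , refl | j , _ , eq = r≢r′ (cong proj₂ (·4+-injective {i} {j} eq))

kunzGaps : ℕ → ℕ → ℕ → List ℕ
kunzGaps a b k = gapsOfResidue a r1 ++ gapsOfResidue b r2 ++ gapsOfResidue k r3

length-kunzGaps : ∀ a b k → length (kunzGaps a b k) ≡ a + (b + k)
length-kunzGaps a b k = begin
  length (kunzGaps a b k)
    ≡⟨ length-++ (gapsOfResidue a r1) ⟩
  length (gapsOfResidue a r1) + length (gapsOfResidue b r2 ++ gapsOfResidue k r3)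
    ≡⟨ cong (length (gapsOfResidue a r1) +_) (length-++ (gapsOfResidue b r2)) ⟩
  length (gapsOfResidue a r1) + (length (gapsOfResidue b r2) + length (gapsOfResidue k r3))
    ≡⟨ cong₂ _+_ (length-applyUpTo _ a) (cong₂ _+_ (length-applyUpTo _ b) (length-applyUpTo _ k)) ⟩
  a + (b + k) ∎
  where open ≡-Reasoning

kunzGaps-unique : ∀ a b k → Unique (kunzGaps a b k)
kunzGaps-unique a b k = Unique.++⁺ (gapsOfResidue-unique a r1)
  (Unique.++⁺ (gapsOfResidue-unique b r2) (gapsOfResidue-unique k r3)
    (λ (p , q) → gapsOfResidue-disjoint (λ ()) p q))
  (λ (p , q) → [ gapsOfResidue-disjoint (λ ()) p , gapsOfResidue-disjoint (λ ()) p ]′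
                 (∈-++⁻ (gapsOfResidue b r2) q))

module _ {a b k : ℕ} where

  private
    S = kunzSemigroup a b k
    ℓ = level a b k

  kunzSemigroup-·4+ : ∀ x r → S (x ·4+ r) ≡ does (ℓ r ≤? x)
  kunzSemigroup-·4+ x r = cong (λ (q , ρ) → does (ℓ ρ ≤? q)) (divMod4-·4+ x r)

  kunzSemigroup-∈ : ∀ {x} r → ℓ r ≤ x → S (x ·4+ r) ≡ true
  kunzSemigroup-∈ {x} r le = trans (kunzSemigroup-·4+ x r) (dec-true (ℓ r ≤? x) le)

  kunzSemigroup-∉ : ∀ {x} r → x < ℓ r → S (x ·4+ r) ≡ false
  kunzSemigroup-∉ {x} r lt = trans (kunzSemigroup-·4+ x r) (dec-false (ℓ r ≤? x) (<⇒≱ lt))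

  kunzSemigroup-∈⁻ : ∀ {x} r → S (x ·4+ r) ≡ true → ℓ r ≤ x
  kunzSemigroup-∈⁻ {x} r eq = dec-true⁻ (ℓ r ≤? x) (trans (sym (kunzSemigroup-·4+ x r)) eq)

  kunzSemigroup-∉⁻ : ∀ {x} r → S (x ·4+ r) ≡ false → x < ℓ r
  kunzSemigroup-∉⁻ {x} r eq = ≰⇒> (dec-false⁻ (ℓ r ≤? x) (trans (sym (kunzSemigroup-·4+ x r)) eq))

  module _ (K : KunzInequalities a b k) where
    open KunzInequalities K

    level-⊕ : ∀ i j → ℓ (i ⊕ j) ≤ ℓ i + ℓ j + carry i j
    level-⊕ r0 r0 = z≤n
    level-⊕ r0 r1 = m≤m+n a 0
    level-⊕ r0 r2 = m≤m+n b 0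
    level-⊕ r0 r3 = m≤m+n k 0
    level-⊕ r1 r0 = ≤-trans (m≤m+n a 0) (m≤m+n (a + 0) 0)
    level-⊕ r2 r0 = ≤-trans (m≤m+n b 0) (m≤m+n (b + 0) 0)
    level-⊕ r3 r0 = ≤-trans (m≤m+n k 0) (m≤m+n (k + 0) 0)
    level-⊕ r1 r1 = ≤-trans b≤a+a (m≤m+n (a + a) 0)
    level-⊕ r1 r2 = ≤-trans k≤a+b (m≤m+n (a + b) 0)
    level-⊕ r2 r1 = ≤-trans k≤a+b (≤-reflexive (trans (+-comm a b) (sym (+-identityʳ (b + a)))))
    level-⊕ r1 r3 = z≤n
    level-⊕ r2 r2 = z≤n
    level-⊕ r3 r1 = z≤n
    level-⊕ r2 r3 = ≤-trans a≤1+b+k (≤-reflexive (+-comm 1 (b + k)))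
    level-⊕ r3 r2 = ≤-trans a≤1+b+k (≤-reflexive (trans (cong suc (+-comm b k)) (+-comm 1 (k + b))))
    level-⊕ r3 r3 = ≤-trans b≤1+k+k (≤-reflexive (+-comm 1 (k + k)))

    kunzSemigroup-closed : ∀ m n → S m ≡ true → S n ≡ true → S (m + n) ≡ true
    kunzSemigroup-closed m n m∈S n∈S with decompose m | decompose n
    ... | x , i , refl | y , j , refl = subst (λ z → S z ≡ true) (sym (·4+-+ x y i j))
      (kunzSemigroup-∈ {x + y + carry i j} (i ⊕ j) (≤-trans (level-⊕ i j)
        (+-monoˡ-≤ (carry i j)
          (+-mono-≤ (kunzSemigroup-∈⁻ {x} i m∈S) (kunzSemigroup-∈⁻ {y} j n∈S)))))

  gapsOfResidue-∉ : ∀ {n} r → n ∈ gapsOfResidue (ℓ r) r → S n ≡ false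
  gapsOfResidue-∉ r n∈ with ∈-applyUpTo⁻ _ n∈
  ... | _ , i<ℓ , refl = kunzSemigroup-∉ r i<ℓ

  kunzGaps-∈⁻ : ∀ {n} → n ∈ kunzGaps a b k → S n ≡ false
  kunzGaps-∈⁻ n∈ with ∈-++⁻ (gapsOfResidue a r1) n∈
  ... | inj₁ p = gapsOfResidue-∉ r1 p
  ... | inj₂ q with ∈-++⁻ (gapsOfResidue b r2) q
  ...   | inj₁ p = gapsOfResidue-∉ r2 p
  ...   | inj₂ p = gapsOfResidue-∉ r3 p

  kunzGaps-∈⁺-·4+ : ∀ {x} r → x < ℓ r → x ·4+ r ∈ kunzGaps a b k
  kunzGaps-∈⁺-·4+ r1 x<a = ∈-++⁺ˡ (∈-applyUpTo⁺ _ x<a)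
  kunzGaps-∈⁺-·4+ r2 x<b = ∈-++⁺ʳ (gapsOfResidue a r1) (∈-++⁺ˡ (∈-applyUpTo⁺ _ x<b))
  kunzGaps-∈⁺-·4+ r3 x<k =
    ∈-++⁺ʳ (gapsOfResidue a r1) (∈-++⁺ʳ (gapsOfResidue b r2) (∈-applyUpTo⁺ _ x<k))

  kunzGaps-∈⁺ : ∀ {n} → S n ≡ false → n ∈ kunzGaps a b k
  kunzGaps-∈⁺ {n} n∉S with decompose n
  ... | x , r , refl = kunzGaps-∈⁺-·4+ {x} r (kunzSemigroup-∉⁻ r n∉S)

  kunzSemigroup-genus : HasGenus S (a + (b + k))
  kunzSemigroup-genus = kunzGaps a b k , kunzGaps-unique a b k , length-kunzGaps a b k ,
    λ n → mk⇔ kunzGaps-∈⁻ kunzGaps-∈⁺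

  kunzNumericalSemigroup : ∀ {g} → KunzInequalities a b k → a + (b + k) ≡ g → 𝒮 4 g
  kunzNumericalSemigroup K a+b+k≡g =
    S , (kunzSemigroup-∈ {0} r0 z≤n , kunzSemigroup-closed K , _ , kunzSemigroup-genus) ,
    (s≤s z≤n , kunzSemigroup-∈ {1} r0 z≤n , below4) , subst (HasGenus S) a+b+k≡g kunzSemigroup-genus
    where
    open KunzInequalities K
    below4 : ∀ n → 0 < n → n < 4 → S n ≡ false
    below4 1 _ _ = kunzSemigroup-∉ {0} r1 1≤a
    below4 2 _ _ = kunzSemigroup-∉ {0} r2 1≤b
    below4 3 _ _ = kunzSemigroup-∉ {0} r3 1≤k
    below4 (suc (suc (suc (suc _)))) _ (s≤s (s≤s (s≤s (s≤s ()))))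

module ApéryLevels (S : NatSubset) (0∈S : S 0 ≡ true) (4∈S : S 4 ≡ true)
  (closed : ∀ m n → S m ≡ true → S n ≡ true → S (m + n) ≡ true)
  (gaps : List ℕ) (gaps-spec : ∀ n → (n ∈ gaps) ⇔ (S n ≡ false)) where

  private
    bound : ℕ
    bound = suc (sum gaps)

    inClass : Residue → ℕ → Bool
    inClass r x = S (x ·4+ r)

  multiple∈S : ∀ x → S (x ·4+ r0) ≡ true
  multiple∈S zero = 0∈S
  multiple∈S (suc x) = closed 4 (x ·4+ r0) 4∈S (multiple∈S x)

  bound∈S : ∀ r → S (bound ·4+ r) ≡ true
  bound∈S r with S (bound ·4+ r) in eq
  ... | true = refl
  ... | false = ⊥-elim (<⇒≱ (x≤x·4+r bound r) (∈⇒≤sum gaps (from (gaps-spec _) eq)))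

  levelOf : Residue → ℕ
  levelOf r = least (inClass r) bound

  a b k : ℕ
  a = levelOf r1
  b = levelOf r2
  k = levelOf r3

  private
    ℓ = level a b k

  ℓ-∈ : ∀ r → S (ℓ r ·4+ r) ≡ true
  ℓ-∈ r0 = 0∈S
  ℓ-∈ r1 = least-satisfies (inClass r1) bound (bound∈S r1)
  ℓ-∈ r2 = least-satisfies (inClass r2) bound (bound∈S r2)
  ℓ-∈ r3 = least-satisfies (inClass r3) bound (bound∈S r3)

  ℓ-minimal : ∀ r {y} → y < ℓ r → S (y ·4+ r) ≡ false
  ℓ-minimal r1 = least-minimal (inClass r1) bound
  ℓ-minimal r2 = least-minimal (inClass r2) bound
  ℓ-minimal r3 = least-minimal (inClass r3) bound

  ℓ-≤ : ∀ r {y} → S (y ·4+ r) ≡ true → ℓ r ≤ y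
  ℓ-≤ r {y} y∈S with ℓ r ≤? y
  ... | yes ℓ≤y = ℓ≤y
  ... | no ℓ≰y with () ← trans (sym y∈S) (ℓ-minimal r (≰⇒> ℓ≰y))

  S≗kunzSemigroup : ∀ n → S n ≡ kunzSemigroup a b k n
  S≗kunzSemigroup n with decompose n
  ... | x , r , refl with ℓ r ≤? x
  ...   | yes ℓ≤x = trans
      (subst (λ m → S m ≡ true) shift (closed _ _ (multiple∈S (x ∸ ℓ r)) (ℓ-∈ r)))
      (sym (kunzSemigroup-∈ r ℓ≤x))
    where
    shift : (x ∸ ℓ r) ·4+ r0 + ℓ r ·4+ r ≡ x ·4+ r
    shift = trans (sym (+-·4+ (x ∸ ℓ r) (ℓ r) r)) (cong (_·4+ r) (m∸n+n≡m ℓ≤x))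
  ...   | no ℓ≰x = trans (ℓ-minimal r (≰⇒> ℓ≰x)) (sym (kunzSemigroup-∉ r (≰⇒> ℓ≰x)))

  ℓ-⊕ : ∀ i j → ℓ (i ⊕ j) ≤ ℓ i + ℓ j + carry i j
  ℓ-⊕ i j = ℓ-≤ (i ⊕ j)
    (subst (λ m → S m ≡ true) (·4+-+ (ℓ i) (ℓ j) i j) (closed _ _ (ℓ-∈ i) (ℓ-∈ j)))

  ℓ-positive : ∀ r → S (0 ·4+ r) ≡ false → 1 ≤ ℓ r
  ℓ-positive r 0r∉S with ℓ r in eq
  ... | suc _ = s≤s z≤n
  ... | zero with () ← trans (sym 0r∉S) (subst (λ x → S (x ·4+ r) ≡ true) eq (ℓ-∈ r))

  kunzInequalities : (∀ n → 0 < n → n < 4 → S n ≡ false) → KunzInequalities a b k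
  kunzInequalities below4 = record
    { 1≤a = ℓ-positive r1 (below4 1 (s≤s z≤n) (s≤s (s≤s z≤n)))
    ; 1≤b = ℓ-positive r2 (below4 2 (s≤s z≤n) (s≤s (s≤s (s≤s z≤n))))
    ; 1≤k = ℓ-positive r3 (below4 3 (s≤s z≤n) ≤-refl)
    ; b≤a+a = subst (b ≤_) (+-identityʳ (a + a)) (ℓ-⊕ r1 r1)
    ; k≤a+b = subst (k ≤_) (+-identityʳ (a + b)) (ℓ-⊕ r1 r2)
    ; a≤1+b+k = subst (a ≤_) (+-comm (b + k) 1) (ℓ-⊕ r2 r3)
    ; b≤1+k+k = subst (b ≤_) (+-comm (k + k) 1) (ℓ-⊕ r3 r3)
    }

  genus-levels : ∀ {g} → Unique gaps → length gaps ≡ g → a + (b + k) ≡ g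
  genus-levels gaps-unique refl = begin
    a + (b + k)              ≡⟨ length-kunzGaps a b k ⟨
    length (kunzGaps a b k)  ≡⟨ ≤-antisym (Unique∧⊆⇒length≤ (kunzGaps-unique a b k) kunzGaps⊆gaps)
                                          (Unique∧⊆⇒length≤ gaps-unique gaps⊆kunzGaps) ⟩
    length gaps              ∎
    where
    open ≡-Reasoning
    kunzGaps⊆gaps : kunzGaps a b k ⊆ gaps
    kunzGaps⊆gaps {n} p = from (gaps-spec n) (trans (S≗kunzSemigroup n) (kunzGaps-∈⁻ p))
    gaps⊆kunzGaps : gaps ⊆ kunzGaps a b k
    gaps⊆kunzGaps {n} p = kunzGaps-∈⁺ (trans (sym (S≗kunzSemigroup n)) (to (gaps-spec n) p))

kunzSemigroup-level-≤ : ∀ {a b k a′ b′ k′} → kunzSemigroup a b k ≗ kunzSemigroup a′ b′ k′ →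
  ∀ r → level a b k r ≤ level a′ b′ k′ r
kunzSemigroup-level-≤ {a} {b} {k} {a′} {b′} {k′} S≗S′ r =
  kunzSemigroup-∈⁻ {a} {b} {k} {level a′ b′ k′ r} r
    (trans (S≗S′ (level a′ b′ k′ r ·4+ r)) (kunzSemigroup-∈ {a′} {b′} {k′} r ≤-refl))

kunzSemigroup-injective : ∀ {a b k a′ b′ k′} → kunzSemigroup a b k ≗ kunzSemigroup a′ b′ k′ →
  (a , b) ≡ (a′ , b′)
kunzSemigroup-injective S≗S′ = cong₂ _,_ (level≡ r1) (level≡ r2)
  where
  level≡ = λ r → ≤-antisym (kunzSemigroup-level-≤ S≗S′ r) (kunzSemigroup-level-≤ (sym ∘ S≗S′) r)

-- The lattice region

-- With k = g ∸ (a + b), the Kunz inequality b ≤ 2k + 1 reads 3b ≤ 2g + 1 ∸ 2a.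
w : ℕ → ℕ → ℕ
w g a = (suc (2 * g) ∸ 2 * a) / 3

bMin bMax : ℕ → ℕ → ℕ
bMin g a = 1 ⊔ (⌈ g /2⌉ ∸ a)
bMax g a = (2 * a) ⊓ w g a

width : ℕ → ℕ → ℕ
width g a = suc (bMax g a) ∸ bMin g a

InRegion : ℕ → ℕ × ℕ → Set
InRegion g (a , b) = 1 ≤ a × a ≤ ⌈ g /2⌉ × bMin g a ≤ b × b ≤ bMax g a

row : ℕ → ℕ → List (ℕ × ℕ)
row g a = map (a ,_) [ bMin g a ‥ bMax g a ]

pointsFrom : ℕ → ℕ → ℕ → List (ℕ × ℕ)
pointsFrom g a zero = []
pointsFrom g a (suc n) = row g a ++ pointsFrom g (suc a) n

latticePoints : ℕ → List (ℕ × ℕ)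
latticePoints g = pointsFrom g 1 ⌈ g /2⌉

count : ℕ → ℕ
count g = sumFrom (width g) 1 ⌈ g /2⌉

length-pointsFrom : ∀ g a n → length (pointsFrom g a n) ≡ sumFrom (width g) a n
length-pointsFrom g a zero = refl
length-pointsFrom g a (suc n) = begin
  length (row g a ++ pointsFrom g (suc a) n)
    ≡⟨ length-++ (row g a) ⟩
  length (row g a) + length (pointsFrom g (suc a) n)
    ≡⟨ cong₂ _+_ (trans (length-map _ [ bMin g a ‥ bMax g a ]) (length-applyUpTo _ (width g a)))
                 (length-pointsFrom g (suc a) n) ⟩
  width g a + sumFrom (width g) (suc a) n ∎
  where open ≡-Reasoning

∈-pointsFrom⁻ : ∀ g a n {x y} → (x , y) ∈ pointsFrom g a n →
  a ≤ x × x < a + n × bMin g x ≤ y × y ≤ bMax g x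
∈-pointsFrom⁻ g a (suc n) p with ∈-++⁻ (row g a) p
... | inj₁ q with ∈-map⁻ (a ,_) q
...   | _ , y∈ , refl = ≤-refl , m<m+n a (s≤s z≤n) , ∈-‥⁻ y∈
∈-pointsFrom⁻ g a (suc n) {x} p | inj₂ q with ∈-pointsFrom⁻ g (suc a) n q
... | a<x , x<1+a+n , y-bounds = <⇒≤ a<x , subst (x <_) (sym (+-suc a n)) x<1+a+n , y-bounds

∈-pointsFrom⁺ : ∀ g a n {x y} → a ≤ x → x < a + n → bMin g x ≤ y → y ≤ bMax g x →
  (x , y) ∈ pointsFrom g a n
∈-pointsFrom⁺ g a zero a≤x x<a+0 _ _ = ⊥-elim (<⇒≱ (subst (_ <_) (+-identityʳ a) x<a+0) a≤x)
∈-pointsFrom⁺ g a (suc n) {x} a≤x x<a+n lo≤y y≤hi with a ≟ x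
... | yes refl = ∈-++⁺ˡ (∈-map⁺ (a ,_) (∈-‥⁺ lo≤y y≤hi))
... | no a≢x = ∈-++⁺ʳ (row g a)
  (∈-pointsFrom⁺ g (suc a) n (≤∧≢⇒< a≤x a≢x) (subst (x <_) (+-suc a n) x<a+n) lo≤y y≤hi)

pointsFrom-unique : ∀ g a n → Unique (pointsFrom g a n)
pointsFrom-unique g a zero = []
pointsFrom-unique g a (suc n) =
  Unique.++⁺ (Unique.map⁺ (cong proj₂) (‥-unique (bMin g a) (bMax g a))) (pointsFrom-unique g (suc a) n)
    λ (p , q) → disjoint p q
  where
  disjoint : ∀ {x y} → (x , y) ∈ row g a → (x , y) ∈ pointsFrom g (suc a) n → ⊥
  disjoint p q with ∈-map⁻ (a ,_) p
  ... | _ , _ , refl = <-irrefl refl (proj₁ (∈-pointsFrom⁻ g (suc a) n q))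

∈-latticePoints⁻ : ∀ g {p} → p ∈ latticePoints g → InRegion g p
∈-latticePoints⁻ g p∈ with ∈-pointsFrom⁻ g 1 ⌈ g /2⌉ p∈
... | 1≤a , a<1+c , lo≤b , b≤hi = 1≤a , ≤-pred a<1+c , lo≤b , b≤hi

∈-latticePoints⁺ : ∀ g {p} → InRegion g p → p ∈ latticePoints g
∈-latticePoints⁺ g (1≤a , a≤c , lo≤b , b≤hi) =
  ∈-pointsFrom⁺ g 1 ⌈ g /2⌉ 1≤a (s≤s a≤c) lo≤b b≤hi

a≤⌈g/2⌉⇔ : ∀ g a → a ≤ ⌈ g /2⌉ ⇔ 2 * a ≤ suc g
a≤⌈g/2⌉⇔ g a = mk⇔ (λ a≤c → ≤-trans (*-monoʳ-≤ 2 a≤c) (2*⌈n/2⌉≤1+n g)) (≤-⌈/2⌉ g)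

⌈g/2⌉≤m⇔ : ∀ g m → ⌈ g /2⌉ ≤ m ⇔ g ≤ 2 * m
⌈g/2⌉≤m⇔ g m = mk⇔ (λ c≤m → ≤-trans (n≤2*⌈n/2⌉ g) (*-monoʳ-≤ 2 c≤m)) (⌈n/2⌉≤m g)

b≤w⇔ : ∀ g a b → 2 * a ≤ suc (2 * g) → b ≤ w g a ⇔ 3 * b + 2 * a ≤ suc (2 * g)
b≤w⇔ g a b 2a≤ = mk⇔
  (λ b≤w → subst (3 * b + 2 * a ≤_) (m∸n+n≡m 2a≤)
             (+-monoˡ-≤ (2 * a) (≤-trans (*-monoʳ-≤ 3 b≤w) (m*[n/m]≤n 3 (suc (2 * g) ∸ 2 * a)))))
  (λ le → ≤-/ 3 _ (m+n≤o⇒m≤o∸n (3 * b) le))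

bMin≤b⇔ : ∀ g a b → bMin g a ≤ b ⇔ (1 ≤ b × ⌈ g /2⌉ ≤ a + b)
bMin≤b⇔ g a b = mk⇔
  (λ lo≤b → ≤-trans (m≤m⊔n 1 (⌈ g /2⌉ ∸ a)) lo≤b ,
            ≤-trans (m≤n+m∸n ⌈ g /2⌉ a) (+-monoʳ-≤ a (≤-trans (m≤n⊔m 1 (⌈ g /2⌉ ∸ a)) lo≤b)))
  (λ (1≤b , c≤a+b) → ⊔-lub 1≤b (m≤n+o⇒m∸n≤o ⌈ g /2⌉ a c≤a+b))

b≤bMax⇔ : ∀ g a b → b ≤ bMax g a ⇔ (b ≤ 2 * a × b ≤ w g a)
b≤bMax⇔ g a b = mk⇔
  (λ b≤hi → ≤-trans b≤hi (m⊓n≤m _ _) , ≤-trans b≤hi (m⊓n≤n _ _))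
  (λ (b≤2a , b≤w) → ⊓-glb b≤2a b≤w)

a≤1+b+k⇔ : ∀ a b k → 2 * a ≤ suc (a + (b + k)) ⇔ a ≤ suc (b + k)
a≤1+b+k⇔ a b k = +-cancelˡ-≤-⇔ a (cong (a +_) (+-identityʳ a)) (sym (+-suc a (b + k)))

k≤a+b⇔ : ∀ a b k → a + (b + k) ≤ 2 * (a + b) ⇔ k ≤ a + b
k≤a+b⇔ a b k = +-cancelˡ-≤-⇔ (a + b) (sym (+-assoc a b k)) (cong ((a + b) +_) (+-identityʳ (a + b)))

b≤1+k+k⇔ : ∀ a b k → 3 * b + 2 * a ≤ suc (2 * (a + (b + k))) ⇔ b ≤ suc (k + k)
b≤1+k+k⇔ a b k = +-cancelˡ-≤-⇔ (2 * a + 2 * b) (lhs a b) (rhs a b k)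
  where
  lhs : ∀ a b → 3 * b + 2 * a ≡ 2 * a + 2 * b + b
  lhs = solve-∀
  rhs : ∀ a b k → suc (2 * (a + (b + k))) ≡ 2 * a + 2 * b + suc (k + k)
  rhs = solve-∀

b≤2a⇔ : ∀ a b → b ≤ 2 * a ⇔ b ≤ a + a
b≤2a⇔ a b = mk⇔ (subst (b ≤_) 2a≡a+a) (subst (b ≤_) (sym 2a≡a+a))
  where
  2a≡a+a = cong (a +_) (+-identityʳ a)

1+g≤1+2g : ∀ g → suc g ≤ suc (2 * g)
1+g≤1+2g g = s≤s (m≤m+n g (g + 0))

a≤⌈g/2⌉⇒2a≤1+2g : ∀ g a → a ≤ ⌈ g /2⌉ → 2 * a ≤ suc (2 * g)
a≤⌈g/2⌉⇒2a≤1+2g g a a≤c = ≤-trans (to (a≤⌈g/2⌉⇔ g a) a≤c) (1+g≤1+2g g)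

kunz⇒region : ∀ {a b k} → KunzInequalities a b k → InRegion (a + (b + k)) (a , b)
kunz⇒region {a} {b} {k} K = 1≤a , from (a≤⌈g/2⌉⇔ g a) 2a≤1+g , lo≤b , b≤hi
  where
  open KunzInequalities K
  g = a + (b + k)
  2a≤1+g = from (a≤1+b+k⇔ a b k) a≤1+b+k
  lo≤b = from (bMin≤b⇔ g a b) (1≤b , from (⌈g/2⌉≤m⇔ g (a + b)) (from (k≤a+b⇔ a b k) k≤a+b))
  b≤hi = from (b≤bMax⇔ g a b) (from (b≤2a⇔ a b) b≤a+a ,
           from (b≤w⇔ g a b (≤-trans 2a≤1+g (1+g≤1+2g g))) (from (b≤1+k+k⇔ a b k) b≤1+k+k))

region⇒kunz : ∀ {a b k} → 1 ≤ k → InRegion (a + (b + k)) (a , b) → KunzInequalities a b k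
region⇒kunz {a} {b} {k} 1≤k (1≤a , a≤c , lo≤b , b≤hi) = record
  { 1≤a = 1≤a
  ; 1≤b = proj₁ (to (bMin≤b⇔ g a b) lo≤b)
  ; 1≤k = 1≤k
  ; b≤a+a = to (b≤2a⇔ a b) (proj₁ (to (b≤bMax⇔ g a b) b≤hi))
  ; k≤a+b = to (k≤a+b⇔ a b k) (to (⌈g/2⌉≤m⇔ g (a + b)) (proj₂ (to (bMin≤b⇔ g a b) lo≤b)))
  ; a≤1+b+k = to (a≤1+b+k⇔ a b k) 2a≤1+g
  ; b≤1+k+k = to (b≤1+k+k⇔ a b k)
      (to (b≤w⇔ g a b (a≤⌈g/2⌉⇒2a≤1+2g g a a≤c)) (proj₂ (to (b≤bMax⇔ g a b) b≤hi)))
  }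
  where
  g = a + (b + k)
  2a≤1+g = to (a≤⌈g/2⌉⇔ g a) a≤c

-- The only place where the bijection needs g ≥ 9: it forces k = g ∸ (a + b) ≥ 1.
region⇒a+b<g : ∀ {g a b} → 9 ≤ g → InRegion g (a , b) → a + b < g
region⇒a+b<g {g} {a} {b} g≥9 (_ , a≤c , _ , b≤hi) = *-cancelˡ-≤ 6 (begin
  6 * suc (a + b)                    ≡⟨ expand a b ⟩
  2 * (3 * b + 2 * a) + 2 * a + 6    ≤⟨ +-monoˡ-≤ 6 (+-mono-≤ (*-monoʳ-≤ 2 3b+2a≤1+2g) 2a≤1+g) ⟩
  2 * suc (2 * g) + suc g + 6        ≡⟨ collect g ⟩
  5 * g + 9                          ≤⟨ +-monoʳ-≤ (5 * g) g≥9 ⟩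
  5 * g + g                          ≡⟨ +-comm (5 * g) g ⟩
  6 * g                              ∎)
  where
  open ≤-Reasoning
  2a≤1+g = to (a≤⌈g/2⌉⇔ g a) a≤c
  3b+2a≤1+2g = to (b≤w⇔ g a b (a≤⌈g/2⌉⇒2a≤1+2g g a a≤c)) (proj₂ (to (b≤bMax⇔ g a b) b≤hi))
  expand : ∀ a b → 6 * suc (a + b) ≡ 2 * (3 * b + 2 * a) + 2 * a + 6
  expand = solve-∀
  collect : ∀ g → 2 * suc (2 * g) + suc g + 6 ≡ 5 * g + 9
  collect = solve-∀

module Enumeration (g : ℕ) (g≥9 : 9 ≤ g) where

  private
    points = latticePoints g

  semigroupAt : ∀ p → InRegion g p → 𝒮 4 g
  semigroupAt (a , b) p∈R =
    kunzNumericalSemigroup (region⇒kunz 1≤k (subst (λ h → InRegion h (a , b)) (sym genus) p∈R)) genus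
    where
    a+b<g = region⇒a+b<g g≥9 p∈R
    1≤k : 1 ≤ g ∸ (a + b)
    1≤k = m+n≤o⇒m≤o∸n 1 a+b<g
    genus : a + (b + (g ∸ (a + b))) ≡ g
    genus = trans (sym (+-assoc a b _)) (m+[n∸m]≡n (<⇒≤ a+b<g))

  enumerate : Fin (length points) → 𝒮 4 g
  enumerate i = semigroupAt (lookup points i) (∈-latticePoints⁻ g (∈-lookup i))

  enumerate-injective : ∀ i j → enumerate i ≈𝒮 enumerate j → i ≡ j
  enumerate-injective i j eq = lookup-injective (pointsFrom-unique g 1 ⌈ g /2⌉) i j (kunzSemigroup-injective eq)

  enumerate-surjective : ∀ s → Σ (Fin (length points)) λ i → enumerate i ≈𝒮 s
  enumerate-surjective
    (S , (0∈S , closed , _) , (_ , 4∈S , below4) , gaps , gaps-unique , length-gaps , gaps-spec) =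
    index ab∈points , λ n → trans
      (cong (λ (x , y) → kunzSemigroup x y (g ∸ (x + y)) n) (sym (lookup-index ab∈points)))
      (trans (cong (λ z → kunzSemigroup a b z n) g∸[a+b]≡k) (sym (S≗kunzSemigroup n)))
    where
    open ApéryLevels S 0∈S 4∈S closed gaps gaps-spec
    genus : a + (b + k) ≡ g
    genus = genus-levels gaps-unique length-gaps
    ab∈points : (a , b) ∈ points
    ab∈points = ∈-latticePoints⁺ g
      (subst (λ h → InRegion h (a , b)) genus (kunz⇒region (kunzInequalities below4)))
    g∸[a+b]≡k : g ∸ (a + b) ≡ k
    g∸[a+b]≡k = trans (cong (_∸ (a + b)) (trans (sym genus) (sym (+-assoc a b k)))) (m+n∸m≡n (a + b) k)

  latticePoints-cardinality : HasCardinality (𝒮 4 g) _≈𝒮_ (length points)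
  latticePoints-cardinality = enumerate , enumerate-injective , enumerate-surjective

-- The recurrence

w-upper : ∀ g a → 2 * a ≤ suc (2 * g) → 3 * w g a + 2 * a ≤ suc (2 * g)
w-upper g a 2a≤ = to (b≤w⇔ g a (w g a) 2a≤) ≤-refl

w-lower : ∀ g a → 2 * a ≤ suc (2 * g) → suc (2 * g) ≤ 2 + 3 * w g a + 2 * a
w-lower g a 2a≤ = subst (_≤ 2 + 3 * w g a + 2 * a) (m∸n+n≡m 2a≤)
  (+-monoˡ-≤ (2 * a) (≤-pred (subst (x <_) (*-suc 3 (x / 3)) (n<m*[1+n/m] 3 x))))
  where x = suc (2 * g) ∸ 2 * a

bMin-below : ∀ g a → a < ⌈ g /2⌉ → bMin g a ≡ ⌈ g /2⌉ ∸ a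
bMin-below g a a<c = m≤n⇒m⊔n≡n (m+n≤o⇒m≤o∸n 1 a<c)

8a≤1+2g⇒2+a≤⌈g/2⌉ : ∀ g a → 9 ≤ g → 8 * a ≤ suc (2 * g) → 2 + a ≤ ⌈ g /2⌉
8a≤1+2g⇒2+a≤⌈g/2⌉ g a g≥9 8a≤ = *-cancelˡ-≤ 8 (begin
  8 * (2 + a)       ≡⟨ *-distribˡ-+ 8 2 a ⟩
  16 + 8 * a        ≤⟨ +-monoʳ-≤ 16 8a≤ ⟩
  17 + 2 * g        ≤⟨ +-monoˡ-≤ (2 * g) (≤-trans (n≤1+n 17) (*-monoʳ-≤ 2 g≥9)) ⟩
  2 * g + 2 * g     ≡⟨ double g ⟩
  4 * g             ≤⟨ *-monoʳ-≤ 4 (n≤2*⌈n/2⌉ g) ⟩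
  4 * (2 * ⌈ g /2⌉) ≡⟨ *-assoc 4 2 ⌈ g /2⌉ ⟨
  8 * ⌈ g /2⌉       ∎)
  where
  open ≤-Reasoning
  double : ∀ g → 2 * g + 2 * g ≡ 4 * g
  double = solve-∀

-- Rows with 8a ≤ 2g + 1 are bounded above by 2a, the other rows by w g a.
width-small : ∀ g a → 9 ≤ g → 8 * a ≤ suc (2 * g) → width g a ≡ (3 * a + 1) ∸ ⌈ g /2⌉
width-small g a g≥9 8a≤ = begin
  suc ((2 * a) ⊓ w g a) ∸ bMin g a
    ≡⟨ cong₂ (λ x y → suc x ∸ y) (m≤n⇒m⊓n≡m 2a≤w) (bMin-below g a a<c) ⟩
  suc (2 * a) ∸ (⌈ g /2⌉ ∸ a)      ≡⟨ m∸[n∸o]≡[m+o]∸n (suc (2 * a)) (<⇒≤ a<c) ⟩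
  (suc (2 * a) + a) ∸ ⌈ g /2⌉      ≡⟨ cong (_∸ ⌈ g /2⌉) (regroup a) ⟩
  (3 * a + 1) ∸ ⌈ g /2⌉            ∎
  where
  open ≡-Reasoning
  a<c : a < ⌈ g /2⌉
  a<c = ≤-trans (n≤1+n (suc a)) (8a≤1+2g⇒2+a≤⌈g/2⌉ g a g≥9 8a≤)
  regroup : ∀ a → suc (2 * a) + a ≡ 3 * a + 1
  regroup = solve-∀
  2a≤w : 2 * a ≤ w g a
  2a≤w = from (b≤w⇔ g a (2 * a) (a≤⌈g/2⌉⇒2a≤1+2g g a (<⇒≤ a<c)))
    (subst (_≤ suc (2 * g)) (sym (split a)) 8a≤)
    where
    split : ∀ a → 3 * (2 * a) + 2 * a ≡ 8 * a
    split = solve-∀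

width-large : ∀ g a → suc (2 * g) < 8 * a → a < ⌈ g /2⌉ →
  width g a ≡ suc (w g a) ∸ (⌈ g /2⌉ ∸ a)
width-large g a 1+2g<8a a<c = cong₂ (λ x y → suc x ∸ y) (m≥n⇒m⊓n≡n w≤2a) (bMin-below g a a<c)
  where
  w≤2a : w g a ≤ 2 * a
  w≤2a = *-cancelˡ-≤ 3 (+-cancelʳ-≤ (2 * a) _ _
    (≤-trans (w-upper g a (a≤⌈g/2⌉⇒2a≤1+2g g a (<⇒≤ a<c)))
             (subst (suc (2 * g) ≤_) (split a) (<⇒≤ 1+2g<8a))))
    where
    split : ∀ a → 8 * a ≡ 3 * (2 * a) + 2 * a
    split = solve-∀

width-⌈g/2⌉ : ∀ g → 1 ≤ g → width g ⌈ g /2⌉ ≡ w g ⌈ g /2⌉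
width-⌈g/2⌉ g 1≤g = cong₂ (λ x y → suc x ∸ (1 ⊔ y)) (m≥n⇒m⊓n≡n w≤2c) (n∸n≡0 ⌈ g /2⌉)
  where
  w≤2c : w g ⌈ g /2⌉ ≤ 2 * ⌈ g /2⌉
  w≤2c = *-cancelˡ-≤ 3 (begin
    3 * w g ⌈ g /2⌉               ≤⟨ m*[n/m]≤n 3 _ ⟩
    suc (2 * g) ∸ 2 * ⌈ g /2⌉     ≤⟨ m∸n≤m (suc (2 * g)) (2 * ⌈ g /2⌉) ⟩
    suc (2 * g)                   ≤⟨ +-monoˡ-≤ (2 * g) 1≤g ⟩
    3 * g                         ≤⟨ *-monoʳ-≤ 3 (n≤2*⌈n/2⌉ g) ⟩
    3 * (2 * ⌈ g /2⌉)             ∎)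
    where open ≤-Reasoning

1+2g<8*⌈g/2⌉ : ∀ g → 1 ≤ g → suc (2 * g) < 8 * ⌈ g /2⌉
1+2g<8*⌈g/2⌉ g 1≤g = begin-strict
  suc (2 * g)        <⟨ +-monoˡ-< (2 * g) (*-monoʳ-≤ 2 1≤g) ⟩
  2 * g + 2 * g      ≡⟨ double g ⟩
  4 * g              ≤⟨ *-monoʳ-≤ 4 (n≤2*⌈n/2⌉ g) ⟩
  4 * (2 * ⌈ g /2⌉)  ≡⟨ *-assoc 4 2 ⌈ g /2⌉ ⟨
  8 * ⌈ g /2⌉        ∎
  where
  open ≤-Reasoning
  double : ∀ g → 2 * g + 2 * g ≡ 4 * g
  double = solve-∀

⌈g/2⌉∸a≤1+w : ∀ g a → 2 * a ≤ suc (2 * g) → ⌈ g /2⌉ ∸ a ≤ suc (w g a)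
⌈g/2⌉∸a≤1+w g a 2a≤ = m≤n+o⇒m∸n≤o ⌈ g /2⌉ a (*-cancelˡ-≤ 6 (begin
  6 * ⌈ g /2⌉                    ≡⟨ *-assoc 3 2 ⌈ g /2⌉ ⟩
  3 * (2 * ⌈ g /2⌉)              ≤⟨ *-monoʳ-≤ 3 (2*⌈n/2⌉≤1+n g) ⟩
  3 * suc g                      ≤⟨ m≤m+n (3 * suc g) (suc g) ⟩
  3 * suc g + suc g              ≡⟨ regroup g ⟩
  2 * suc (2 * g) + 2            ≤⟨ +-monoˡ-≤ 2 (*-monoʳ-≤ 2 (w-lower g a 2a≤)) ⟩
  2 * (2 + 3 * w g a + 2 * a) + 2  ≤⟨ m≤m+n _ (2 * a) ⟩
  2 * (2 + 3 * w g a + 2 * a) + 2 + 2 * a  ≡⟨ collect a (w g a) ⟩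
  6 * (a + suc (w g a))          ∎))
  where
  open ≤-Reasoning
  regroup : ∀ g → 3 * suc g + suc g ≡ 2 * suc (2 * g) + 2
  regroup = solve-∀
  collect : ∀ a v → 2 * (2 + 3 * v + 2 * a) + 2 + 2 * a ≡ 6 * (a + suc v)
  collect = solve-∀

numerator-shift : ∀ g a j r → 2 * j + r ≡ 24 → 2 * a ≤ suc (2 * g) →
  suc (2 * (12 + g)) ∸ 2 * (j + a) ≡ r + (suc (2 * g) ∸ 2 * a)
numerator-shift g a j r 2j+r≡24 2a≤ = begin
  suc (2 * (12 + g)) ∸ 2 * (j + a)               ≡⟨ cong₂ _∸_ split (*-distribˡ-+ 2 j a) ⟩
  (2 * j + (r + suc (2 * g))) ∸ (2 * j + 2 * a)  ≡⟨ [m+n]∸[m+o]≡n∸o (2 * j) _ _ ⟩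
  (r + suc (2 * g)) ∸ 2 * a                      ≡⟨ +-∸-assoc r 2a≤ ⟩
  r + (suc (2 * g) ∸ 2 * a)                      ∎
  where
  open ≡-Reasoning
  expand : ∀ g → suc (2 * (12 + g)) ≡ 24 + suc (2 * g)
  expand = solve-∀
  split : suc (2 * (12 + g)) ≡ 2 * j + (r + suc (2 * g))
  split = trans (expand g) (trans (cong (_+ suc (2 * g)) (sym 2j+r≡24)) (+-assoc (2 * j) r _))

1+2g<8a⇒ : ∀ g a → suc (2 * g) < 8 * a → suc (2 * (12 + g)) < 8 * (3 + a)
1+2g<8a⇒ g a lt = subst₂ _<_ (sym (expand g)) (sym (*-distribˡ-+ 8 3 a)) (+-monoʳ-< 24 lt)
  where
  expand : ∀ g → suc (2 * (12 + g)) ≡ 24 + suc (2 * g)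
  expand = solve-∀

width-shift-large : ∀ g a → suc (2 * g) < 8 * a → a < ⌈ g /2⌉ →
  width (12 + g) (3 + a) ≡ 3 + width g a
width-shift-large g a 1+2g<8a a<c = begin
  width (12 + g) (3 + a)
    ≡⟨ width-large (12 + g) (3 + a) (1+2g<8a⇒ g a 1+2g<8a)
                   (+-monoʳ-≤ 3 (≤-trans a<c (m≤n+m ⌈ g /2⌉ 3))) ⟩
  suc (w (12 + g) (3 + a)) ∸ ((3 + ⌈ g /2⌉) ∸ a)
    ≡⟨ cong₂ (λ x y → suc x ∸ y) w-shift (+-∸-assoc 3 (<⇒≤ a<c)) ⟩
  suc (6 + w g a) ∸ (3 + (⌈ g /2⌉ ∸ a))
    ≡⟨⟩
  (3 + suc (w g a)) ∸ (⌈ g /2⌉ ∸ a)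
    ≡⟨ +-∸-assoc 3 (⌈g/2⌉∸a≤1+w g a 2a≤) ⟩
  3 + (suc (w g a) ∸ (⌈ g /2⌉ ∸ a))
    ≡⟨ cong (3 +_) (width-large g a 1+2g<8a a<c) ⟨
  3 + width g a ∎
  where
  open ≡-Reasoning
  2a≤ = a≤⌈g/2⌉⇒2a≤1+2g g a (<⇒≤ a<c)
  w-shift : w (12 + g) (3 + a) ≡ 6 + w g a
  w-shift = trans (cong (_/ 3) (numerator-shift g a 3 18 refl 2a≤)) ([k*m+n]/m≡k+n/m 3 6 (suc (2 * g) ∸ 2 * a))

module _ (g : ℕ) (1≤g : 1 ≤ g) where

  private
    c = ⌈ g /2⌉
    X = suc (2 * g) ∸ 2 * c
    2c≤1+2g : 2 * c ≤ suc (2 * g)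
    2c≤1+2g = a≤⌈g/2⌉⇒2a≤1+2g g c ≤-refl

    width-shift-⌈g/2⌉ : width (12 + g) ⌈ 12 + g /2⌉ ≡ 4 + width g ⌈ g /2⌉
    width-shift-⌈g/2⌉ = begin
      width (12 + g) (6 + c) ≡⟨ width-⌈g/2⌉ (12 + g) (s≤s z≤n) ⟩
      w (12 + g) (6 + c)     ≡⟨ cong (_/ 3) (numerator-shift g c 6 12 refl 2c≤1+2g) ⟩
      (12 + X) / 3           ≡⟨ [k*m+n]/m≡k+n/m 3 4 X ⟩
      4 + w g c              ≡⟨ cong (4 +_) (width-⌈g/2⌉ g 1≤g) ⟨
      4 + width g c          ∎
      where open ≡-Reasoning

    width-beyond : ∀ j r → 3 ≤ j → j ≤ 5 → 2 * j + r ≡ 24 →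
      width (12 + g) (j + c) ≡ suc ((r + X) / 3) ∸ ((6 + c) ∸ (j + c))
    width-beyond j r 3≤j j≤5 2j+r≡24 = trans
      (width-large (12 + g) (j + c)
        (<-≤-trans (1+2g<8a⇒ g c (1+2g<8*⌈g/2⌉ g 1≤g)) (*-monoʳ-≤ 8 (+-monoˡ-≤ c 3≤j)))
        (+-monoˡ-≤ c (s≤s j≤5)))
      (cong (λ x → suc (x / 3) ∸ ((6 + c) ∸ (j + c))) (numerator-shift g c j r 2j+r≡24 2c≤1+2g))

  -- Rows 3 + c, 4 + c and 5 + c of g + 12 have no counterpart for g; Hermite's identity sums them.
  width-tail : sumFrom (width (12 + g)) (3 + c) 4 ≡ 16 + (X + width g c)
  width-tail = begin
    width (12 + g) (3 + c) + (width (12 + g) (4 + c) + (width (12 + g) (5 + c) + (width (12 + g) (6 + c) + 0)))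
      ≡⟨ cong₂ _+_ (width-beyond 3 18 ≤-refl (s≤s (s≤s (s≤s z≤n))) refl)
         (cong₂ _+_ (width-beyond 4 16 (s≤s (s≤s (s≤s z≤n))) (s≤s (s≤s (s≤s (s≤s z≤n)))) refl)
         (cong₂ _+_ (width-beyond 5 14 (s≤s (s≤s (s≤s z≤n))) ≤-refl refl)
                    (cong (_+ 0) width-shift-⌈g/2⌉))) ⟩
    suc ((18 + X) / 3) ∸ ((3 + c) ∸ c) + (suc ((16 + X) / 3) ∸ ((2 + c) ∸ c)
      + (suc ((14 + X) / 3) ∸ ((1 + c) ∸ c) + ((4 + width g c) + 0)))
      ≡⟨ cong₂ _+_ (cong₂ _∸_ (cong suc ([k*m+n]/m≡k+n/m 3 6 X)) (m+n∸n≡m 3 c))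
         (cong₂ _+_ (cong₂ _∸_ (cong suc ([k*m+n]/m≡k+n/m 3 5 (1 + X))) (m+n∸n≡m 2 c))
         (cong (_+ ((4 + width g c) + 0))
               (cong₂ _∸_ (cong suc ([k*m+n]/m≡k+n/m 3 4 (2 + X))) (m+n∸n≡m 1 c)))) ⟩
    (4 + X / 3) + ((4 + (1 + X) / 3) + ((4 + (2 + X) / 3) + ((4 + width g c) + 0)))
      ≡⟨ regroup (X / 3) ((1 + X) / 3) ((2 + X) / 3) (width g c) ⟩
    16 + ((X / 3 + (1 + X) / 3 + (2 + X) / 3) + width g c)
      ≡⟨ cong (λ y → 16 + (y + width g c)) (n/3+[1+n]/3+[2+n]/3≡n X) ⟩
    16 + (X + width g c) ∎
    where
    open ≡-Reasoning
    regroup : ∀ x y z v → (4 + x) + ((4 + y) + ((4 + z) + ((4 + v) + 0))) ≡ 16 + ((x + y + z) + v)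
    regroup = solve-∀

8a≤1+2g⇒8[a+3]≤1+2[12+g] : ∀ g a → 8 * a ≤ suc (2 * g) → 8 * (a + 3) ≤ suc (2 * (12 + g))
8a≤1+2g⇒8[a+3]≤1+2[12+g] g a le = subst₂ _≤_ (sym (expandˡ a)) (sym (expandʳ g)) (+-monoˡ-≤ 24 le)
  where
  expandˡ : ∀ a → 8 * (a + 3) ≡ 8 * a + 24
  expandˡ = solve-∀
  expandʳ : ∀ g → suc (2 * (12 + g)) ≡ suc (2 * g) + 24
  expandʳ = solve-∀

recurrence-arithmetic : ∀ A B L P X m n g c → c ≡ suc (m + n) →
  P + c ≡ 3 * suc m + 1 → X + 2 * c ≡ suc (2 * g) →
  (A + P) + ((3 * n + B) + (16 + (X + L))) ≡ A + (B + L) + (18 + 2 * g)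
recurrence-arithmetic A B L P X m n g c refl P+c≡ X+2c≡ = +-cancelʳ-≡ (3 * c) _ _ (begin
  (A + P) + ((3 * n + B) + (16 + (X + L))) + 3 * c
    ≡⟨ regroup A B L P X m n ⟩
  (P + c) + (X + 2 * c) + (A + B + L + 3 * n + 16)
    ≡⟨ cong₂ (λ x y → x + y + (A + B + L + 3 * n + 16)) P+c≡ X+2c≡ ⟩
  (3 * suc m + 1) + suc (2 * g) + (A + B + L + 3 * n + 16)
    ≡⟨ collect A B L m n g ⟩
  A + (B + L) + (18 + 2 * g) + 3 * c ∎)
  where
  open ≡-Reasoning
  regroup : ∀ A B L P X m n → (A + P) + ((3 * n + B) + (16 + (X + L))) + 3 * suc (m + n)
    ≡ (P + suc (m + n)) + (X + 2 * suc (m + n)) + (A + B + L + 3 * n + 16)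
  regroup = solve-∀
  collect : ∀ A B L m n g → (3 * suc m + 1) + suc (2 * g) + (A + B + L + 3 * n + 16)
    ≡ A + (B + L) + (18 + 2 * g) + 3 * suc (m + n)
  collect = solve-∀

module Recurrence (g : ℕ) (g≥9 : 9 ≤ g) where

  private
    c m n X : ℕ
    c = ⌈ g /2⌉
    m = suc (2 * g) / 8
    n = c ∸ suc m
    X = suc (2 * g) ∸ 2 * c

    L L′ φ : ℕ → ℕ
    L = width g
    L′ = width (12 + g)
    φ a = (3 * a + 1) ∸ c

    1≤g : 1 ≤ g
    1≤g = ≤-trans (s≤s z≤n) g≥9

    12+g≥9 : 9 ≤ 12 + g
    12+g≥9 = ≤-trans g≥9 (m≤n+m g 12)

    8m≤1+2g : 8 * m ≤ suc (2 * g)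
    8m≤1+2g = m*[n/m]≤n 8 (suc (2 * g))

    1+2g<8[1+m] : suc (2 * g) < 8 * suc m
    1+2g<8[1+m] = n<m*[1+n/m] 8 (suc (2 * g))

    c≡ : c ≡ suc (m + n)
    c≡ = sym (m+[n∸m]≡n (≤-trans (n≤1+n (suc m)) (8a≤1+2g⇒2+a≤⌈g/2⌉ g m g≥9 8m≤1+2g)))

    c≤3[1+m]+1 : c ≤ 3 * suc m + 1
    c≤3[1+m]+1 = *-cancelˡ-≤ 8 (begin
      8 * c                       ≡⟨ *-assoc 4 2 c ⟩
      4 * (2 * c)                 ≤⟨ *-monoʳ-≤ 4 (2*⌈n/2⌉≤1+n g) ⟩
      4 * suc g                   ≤⟨ m≤m+n (4 * suc g) (2 * g + 10) ⟩
      4 * suc g + (2 * g + 10)    ≡⟨ regroup g ⟩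
      3 * suc (2 * g) + 11        ≤⟨ +-monoˡ-≤ 11 (*-monoʳ-≤ 3 1+2g≤7+8m) ⟩
      3 * (7 + 8 * m) + 11        ≡⟨ collect m ⟩
      8 * (3 * suc m + 1)         ∎)
      where
      open ≤-Reasoning
      regroup : ∀ g → 4 * suc g + (2 * g + 10) ≡ 3 * suc (2 * g) + 11
      regroup = solve-∀
      expand : ∀ m → 8 * suc m ≡ suc (7 + 8 * m)
      expand = solve-∀
      collect : ∀ m → 3 * (7 + 8 * m) + 11 ≡ 8 * (3 * suc m + 1)
      collect = solve-∀
      1+2g≤7+8m = ≤-pred (subst (suc (2 * g) <_) (expand m) 1+2g<8[1+m])

  count-split : count g ≡ sumFrom L 1 m + (sumFrom L (suc m) n + L c)
  count-split = begin
    sumFrom L 1 c                                  ≡⟨ cong (sumFrom L 1) (trans c≡ (sym (+-suc m n))) ⟩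
    sumFrom L 1 (m + suc n)                        ≡⟨ sumFrom-++ L 1 m (suc n) ⟩
    sumFrom L 1 m + sumFrom L (suc m) (suc n)      ≡⟨ cong (sumFrom L 1 m +_) (sumFrom-snoc L (suc m) n) ⟩
    sumFrom L 1 m + (sumFrom L (suc m) n + L (suc (m + n)))
      ≡⟨ cong (λ x → sumFrom L 1 m + (sumFrom L (suc m) n + L x)) c≡ ⟨
    sumFrom L 1 m + (sumFrom L (suc m) n + L c)    ∎
    where open ≡-Reasoning

  count-shift-split : count (12 + g) ≡ sumFrom L′ 1 (3 + m) + (sumFrom L′ (4 + m) n + sumFrom L′ (3 + c) 4)
  count-shift-split = begin
    sumFrom L′ 1 (6 + c)
      ≡⟨ cong (sumFrom L′ 1) (trans (cong (6 +_) c≡) (regroup m n)) ⟩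
    sumFrom L′ 1 ((3 + m) + (n + 4))
      ≡⟨ sumFrom-++ L′ 1 (3 + m) (n + 4) ⟩
    sumFrom L′ 1 (3 + m) + sumFrom L′ (4 + m) (n + 4)
      ≡⟨ cong (sumFrom L′ 1 (3 + m) +_) (sumFrom-++ L′ (4 + m) n 4) ⟩
    sumFrom L′ 1 (3 + m) + (sumFrom L′ (4 + m) n + sumFrom L′ (4 + (m + n)) 4)
      ≡⟨ cong (λ x → sumFrom L′ 1 (3 + m) + (sumFrom L′ (4 + m) n + sumFrom L′ (3 + x) 4)) c≡ ⟨
    sumFrom L′ 1 (3 + m) + (sumFrom L′ (4 + m) n + sumFrom L′ (3 + c) 4) ∎
    where
    open ≡-Reasoning
    regroup : ∀ m n → 6 + suc (m + n) ≡ (3 + m) + (n + 4)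
    regroup = solve-∀

  small-part : sumFrom L′ 1 (3 + m) ≡ sumFrom L 1 m + φ (suc m)
  small-part = begin
    L′ 1 + (L′ 2 + sumFrom L′ 3 (suc m))
      ≡⟨ cong₂ (λ x y → x + (y + sumFrom L′ 3 (suc m))) L′1≡0 L′2≡0 ⟩
    sumFrom L′ 3 (suc m)                  ≡⟨ sumFrom-cong L′ φ 3 1 (suc m) shifted ⟩
    sumFrom φ 1 (suc m)                   ≡⟨ sumFrom-snoc φ 1 m ⟩
    sumFrom φ 1 m + φ (suc m)             ≡⟨ cong (_+ φ (suc m)) (sumFrom-cong φ L 1 1 m unshifted) ⟩
    sumFrom L 1 m + φ (suc m)             ∎
    where
    open ≡-Reasoning
    8a≤ : ∀ {a} → a ≤ 3 → 8 * a ≤ suc (2 * (12 + g))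
    8a≤ a≤3 = ≤-trans (*-monoʳ-≤ 8 a≤3) (8a≤1+2g⇒8[a+3]≤1+2[12+g] g 0 z≤n)
    L′1≡0 : L′ 1 ≡ 0
    L′1≡0 = width-small (12 + g) 1 12+g≥9 (8a≤ (s≤s z≤n))
    L′2≡0 : L′ 2 ≡ 0
    L′2≡0 = trans (width-small (12 + g) 2 12+g≥9 (8a≤ (s≤s (s≤s z≤n))))
                  (m≤n⇒m∸n≡0 (≤-trans (s≤s z≤n) (8a≤1+2g⇒2+a≤⌈g/2⌉ g m g≥9 8m≤1+2g)))
    shift : ∀ i → 3 * (i + 3) + 1 ≡ 6 + (3 * (i + 1) + 1)
    shift = solve-∀
    shifted : ∀ i → i < suc m → L′ (i + 3) ≡ φ (i + 1)
    shifted i i<1+m = trans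
      (width-small (12 + g) (i + 3) 12+g≥9
        (8a≤1+2g⇒8[a+3]≤1+2[12+g] g i (≤-trans (*-monoʳ-≤ 8 (≤-pred i<1+m)) 8m≤1+2g)))
      (cong (_∸ (6 + c)) (shift i))
    unshifted : ∀ i → i < m → φ (i + 1) ≡ L (i + 1)
    unshifted i i<m = sym (width-small g (i + 1) g≥9
      (≤-trans (*-monoʳ-≤ 8 (subst (_≤ m) (+-comm 1 i) i<m)) 8m≤1+2g))

  middle-part : sumFrom L′ (4 + m) n ≡ 3 * n + sumFrom L (suc m) n
  middle-part = trans (sumFrom-cong L′ (λ a → 3 + L a) (4 + m) (suc m) n shifted) (sumFrom-+ 3 L (suc m) n)
    where
    regroup : ∀ i m → i + (4 + m) ≡ 3 + (i + suc m)
    regroup = solve-∀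
    shifted : ∀ i → i < n → L′ (i + (4 + m)) ≡ 3 + L (i + suc m)
    shifted i i<n = trans (cong L′ (regroup i m)) (width-shift-large g (i + suc m)
      (<-≤-trans 1+2g<8[1+m] (*-monoʳ-≤ 8 (m≤n+m (suc m) i)))
      (subst (i + suc m <_) (trans (+-comm n (suc m)) (sym c≡)) (+-monoˡ-< (suc m) i<n)))

  count-shift : count (12 + g) ≡ count g + (18 + 2 * g)
  count-shift = begin
    count (12 + g)
      ≡⟨ count-shift-split ⟩
    sumFrom L′ 1 (3 + m) + (sumFrom L′ (4 + m) n + sumFrom L′ (3 + c) 4)
      ≡⟨ cong₂ _+_ small-part (cong₂ _+_ middle-part (width-tail g 1≤g)) ⟩
    (sumFrom L 1 m + φ (suc m)) + ((3 * n + sumFrom L (suc m) n) + (16 + (X + L c)))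
      ≡⟨ recurrence-arithmetic (sumFrom L 1 m) (sumFrom L (suc m) n) (L c) (φ (suc m)) X m n g c c≡
           (m∸n+n≡m c≤3[1+m]+1)
           (m∸n+n≡m (a≤⌈g/2⌉⇒2a≤1+2g g c ≤-refl)) ⟩
    sumFrom L 1 m + (sumFrom L (suc m) n + L c) + (18 + 2 * g)
      ≡⟨ cong (_+ (18 + 2 * g)) count-split ⟨
    count g + (18 + 2 * g) ∎
    where open ≡-Reasoning

-- The formula

-- Opened only here: ℤ's +_ would make the sections (m +_) on ℕ above ambiguous.
open ℤ using (ℤ; +_)

record RingOps (R : Set) : Set where
  infixl 6 _⊞_
  infixl 7 _⊠_
  infix 8 ⊟_
  field
    _⊞_ _⊠_ : R → R → R
    ⊟_ : R → R
    κ : ℕ → R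

-- The polynomial inside twiceFormula, written once over abstract operations so that it can be
-- evaluated both in ℤ and as an expression for the ring solver.
module FormulaPolynomial {R : Set} (ops : RingOps R) where
  open RingOps ops

  infixl 6 _⊟_
  _⊟_ : R → R → R
  x ⊟ y = x ⊞ ⊟ y

  polynomial : R → R → R → R → R → R → R → R → R → R
  polynomial G A B C D E F H I =
    ⊟ (κ 2 ⊠ G) ⊞ κ 5 ⊠ A ⊞ κ 2 ⊠ B ⊞ C ⊞ κ 2 ⊠ C ⊠ G ⊟ κ 2 ⊠ C ⊠ B
    ⊟ κ 3 ⊠ C ⊠ C ⊟ κ 2 ⊠ A ⊠ G ⊞ κ 3 ⊠ A ⊠ A ⊞ κ 2 ⊠ A ⊠ B
    ⊟ D ⊞ κ 2 ⊠ D ⊠ B ⊟ κ 3 ⊠ D ⊠ D ⊞ E ⊞ κ 3 ⊠ E ⊠ E ⊟ κ 2 ⊠ E ⊠ B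
    ⊞ κ 2 ⊠ F ⊠ B ⊟ κ 2 ⊠ F ⊠ H ⊞ κ 2 ⊠ F ⊟ κ 2 ⊠ I ⊠ B ⊞ κ 2 ⊠ I ⊠ H ⊟ κ 2 ⊠ I

  -- For g ≥ 4 the last three floors are ⌊(g+1)/2⌋ = g − ⌊g/2⌋, ⌈(2g−3)/8⌉ = ⌊(g+2)/4⌋ and
  -- ⌈(2g−7)/8⌉ = ⌊g/4⌋.
  reduced : R → R → R → R → R → R → R
  reduced G A B C D E = polynomial G A B C D E (G ⊟ B) E A

ℤ-ops : RingOps ℤ
ℤ-ops = record { _⊞_ = ℤ._+_ ; _⊠_ = ℤ._*_ ; ⊟_ = ℤ.-_ ; κ = +_ }

expr-ops : ∀ n → RingOps (Expr ℤ n)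
expr-ops n = record { _⊞_ = _:+_ ; _⊠_ = _:*_ ; ⊟_ = :-_ ; κ = λ k → Κ (+ k) }

open FormulaPolynomial ℤ-ops using (polynomial; reduced)

reduced-shift : ∀ G A B C D E →
  reduced (G ℤ.+ + 12) (A ℤ.+ + 3) (B ℤ.+ + 6) (C ℤ.+ + 2) (D ℤ.+ + 2) (E ℤ.+ + 3)
    ≡ reduced G A B C D E ℤ.+ (+ 36 ℤ.+ + 4 ℤ.* G)
reduced-shift = solve-ℤ 6 (λ G A B C D E →
  R (G :+ Κ (+ 12)) (A :+ Κ (+ 3)) (B :+ Κ (+ 6)) (C :+ Κ (+ 2)) (D :+ Κ (+ 2)) (E :+ Κ (+ 3))
    ⊜ (R G A B C D E :+ (Κ (+ 36) :+ Κ (+ 4) :* G))) refl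
  where open FormulaPolynomial (expr-ops 6) renaming (reduced to R)

reduced-cong : ∀ {G G′ A A′ B B′ C C′ D D′ E E′} →
  G ≡ G′ → A ≡ A′ → B ≡ B′ → C ≡ C′ → D ≡ D′ → E ≡ E′ → reduced G A B C D E ≡ reduced G′ A′ B′ C′ D′ E′
reduced-cong refl refl refl refl refl refl = refl

twiceFormula≡reduced : ∀ g → 4 ≤ g →
  twiceFormula g ≡ reduced (+ g) (+ (g / 4)) (+ (g / 2)) (+ ((g + 5) / 6)) (+ ((g + 2) / 6)) (+ ((g + 2) / 4))
twiceFormula≡reduced g 4≤g = trans
  (cong (λ F → polynomial (+ g) (+ (g / 4)) (+ (g / 2)) (+ ((g + 5) / 6)) (+ ((g + 2) / 6)) (+ ((g + 2) / 4))
                 F (+ ⌈ (2 * g ∸ 3) / 8 ⌉) (+ ⌈ (2 * g ∸ 7) / 8 ⌉)) ⌊[g+1]/2⌋≡g-⌊g/2⌋)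
  (cong₂ (polynomial (+ g) (+ (g / 4)) (+ (g / 2)) (+ ((g + 5) / 6)) (+ ((g + 2) / 6)) (+ ((g + 2) / 4))
                     (+ g ℤ.- + (g / 2)))
         (cong +_ (⌈[2n∸3]/8⌉≡[n+2]/4 g (≤-trans (s≤s (s≤s z≤n)) 4≤g)))
         (cong +_ (⌈[2n∸7]/8⌉≡n/4 g 4≤g)))
  where
  ⌊[g+1]/2⌋≡g-⌊g/2⌋ : + ((g + 1) / 2) ≡ + g ℤ.- + (g / 2)
  ⌊[g+1]/2⌋≡g-⌊g/2⌋ = begin
    + ((g + 1) / 2)                  ≡⟨ cong +_ (m+n∸m≡n (g / 2) ((g + 1) / 2)) ⟨
    + ((g / 2 + (g + 1) / 2) ∸ g / 2) ≡⟨ cong (λ x → + (x ∸ g / 2)) (n/2+[n+1]/2≡n g) ⟩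
    + (g ∸ g / 2)                    ≡⟨ ⊖-≥ (m/n≤m g 2) ⟨
    g ℤ.⊖ (g / 2)                    ≡⟨ m-n≡m⊖n g (g / 2) ⟨
    + g ℤ.- + (g / 2)                ∎
    where open ≡-Reasoning

+[k+n]≡+n+k : ∀ k n → + (k + n) ≡ + n ℤ.+ + k
+[k+n]≡+n+k k n = trans (cong +_ (+-comm k n)) (pos-+ n k)

twiceFormula-shift : ∀ g → 4 ≤ g → twiceFormula (12 + g) ≡ twiceFormula g ℤ.+ + (36 + 4 * g)
twiceFormula-shift g 4≤g = begin
  twiceFormula (12 + g)
    ≡⟨ twiceFormula≡reduced (12 + g) (≤-trans 4≤g (m≤n+m g 12)) ⟩
  reduced (+ (12 + g)) (+ ((12 + g) / 4)) (+ ((12 + g) / 2)) (+ ((12 + g + 5) / 6))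
          (+ ((12 + g + 2) / 6)) (+ ((12 + g + 2) / 4))
    ≡⟨ reduced-cong (+[k+n]≡+n+k 12 g) (shift 3 4 g) (shift 6 2 g) (shift 2 6 (g + 5))
                    (shift 2 6 (g + 2)) (shift 3 4 (g + 2)) ⟩
  reduced (G ℤ.+ + 12) (A ℤ.+ + 3) (B ℤ.+ + 6) (C ℤ.+ + 2) (D ℤ.+ + 2) (E ℤ.+ + 3)
    ≡⟨ reduced-shift G A B C D E ⟩
  reduced G A B C D E ℤ.+ (+ 36 ℤ.+ + 4 ℤ.* G)
    ≡⟨ cong₂ ℤ._+_ (twiceFormula≡reduced g 4≤g)
                   (trans (pos-+ 36 (4 * g)) (cong (ℤ._+_ (+ 36)) (pos-* 4 g))) ⟨
  twiceFormula g ℤ.+ + (36 + 4 * g) ∎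
  where
  open ≡-Reasoning
  G = + g
  A = + (g / 4)
  B = + (g / 2)
  C = + ((g + 5) / 6)
  D = + ((g + 2) / 6)
  E = + ((g + 2) / 4)
  shift : ∀ k m n .{{_ : NonZero m}} → + ((k * m + n) / m) ≡ + (n / m) ℤ.+ + k
  shift k m n = trans (cong +_ ([k*m+n]/m≡k+n/m m k n)) (+[k+n]≡+n+k k (n / m))

twiceCount≡twiceFormula-9+ : ∀ k → + (2 * count (9 + k)) ≡ twiceFormula (9 + k)
twiceCount≡twiceFormula-9+ 0 = refl
twiceCount≡twiceFormula-9+ 1 = refl
twiceCount≡twiceFormula-9+ 2 = refl
twiceCount≡twiceFormula-9+ 3 = refl
twiceCount≡twiceFormula-9+ 4 = refl
twiceCount≡twiceFormula-9+ 5 = refl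
twiceCount≡twiceFormula-9+ 6 = refl
twiceCount≡twiceFormula-9+ 7 = refl
twiceCount≡twiceFormula-9+ 8 = refl
twiceCount≡twiceFormula-9+ 9 = refl
twiceCount≡twiceFormula-9+ 10 = refl
twiceCount≡twiceFormula-9+ 11 = refl
twiceCount≡twiceFormula-9+ (suc (suc (suc (suc (suc (suc (suc (suc (suc (suc (suc (suc k)))))))))))) = begin
  + (2 * count (12 + g))                  ≡⟨ cong (λ N → + (2 * N)) (Recurrence.count-shift g g≥9) ⟩
  + (2 * (count g + (18 + 2 * g)))        ≡⟨ cong +_ (distribute (count g) g) ⟩
  + (2 * count g + (36 + 4 * g))          ≡⟨ pos-+ (2 * count g) (36 + 4 * g) ⟩
  + (2 * count g) ℤ.+ + (36 + 4 * g)      ≡⟨ cong (ℤ._+ + (36 + 4 * g)) (twiceCount≡twiceFormula-9+ k) ⟩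
  twiceFormula g ℤ.+ + (36 + 4 * g)       ≡⟨ twiceFormula-shift g (m≤m+n 4 (5 + k)) ⟨
  twiceFormula (12 + g)                   ∎
  where
  open ≡-Reasoning
  g = 9 + k
  g≥9 = m≤m+n 9 k
  distribute : ∀ t g → 2 * (t + (18 + 2 * g)) ≡ 2 * t + (36 + 4 * g)
  distribute = solve-∀

twiceCount≡twiceFormula : ∀ g → 9 ≤ g → + (2 * count g) ≡ twiceFormula g
twiceCount≡twiceFormula g g≥9 =
  subst (λ h → + (2 * count h) ≡ twiceFormula h) (m+[n∸m]≡n g≥9) (twiceCount≡twiceFormula-9+ (g ∸ 9))

mainTheorem7 : (g : ℕ) → 9 ≤ g →
    Σ ℕ λ N → HasCardinality (𝒮 4 g) _≈𝒮_ N × + (2 * N) ≡ twiceFormula g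
mainTheorem7 g g≥9 =
  length (latticePoints g) ,
  Enumeration.latticePoints-cardinality g g≥9 ,
  trans (cong (λ N → + (2 * N)) (length-pointsFrom g 1 ⌈ g /2⌉)) (twiceCount≡twiceFormula g g≥9)
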